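{- Let $q$ be a prime power, $k\ge 2$, $n=[k]_q=\frac{q^k-1}{q-1}$, and $V=\mathbb{F}_q^n$. Let $1\le m\le k$. If $X\subseteq V$ is an $m$-dimensional subspace contained in some $q$-ary simplex code of dimension $k$ in $V$, then every generator matrix $M$ of $X$ satisfies the condition $(*)_m$: $M$ contains precisely $[k-m]_q$ zero columns, and every non-zero column of $M$ is proportional to precisely $q^{k-m}$ columns of $M$ (including itself). Conversely, if some generator matrix $M$ of an $m$-dimensional subspace $X\subseteq V$ satisfies $(*)_m$, then $X$ is contained in a $q$-ary simplex code of dimension $k$ in $V$.
   Context: For a natural number $s$, $[s]_q=\frac{q^s-1}{q-1}$ (with $[0]_q=0$). A linear code is a subspace of $V=\mathbb{F}_q^n$; a generator matrix of an $m$-dimensional code is an $m\times n$ matrix whose rows form a basis of it. A $k$-dimensional subspace $C\subseteq V$ (with $n=[k]_q$) is a $q$-ary simplex code of dimension $k$ if the columns of a (equivalently, every) generator matrix of $C$ are non-zero and mutually non-proportional (equivalently, the restrictions of the $n$ coordinate functionals to $C$ are non-zero and pairwise non-proportional). -}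

module Defs where

open import Level using (Level; _⊔_) renaming (suc to lsuc)
open import Algebra.Bundles using (CommutativeRing)
open import Data.Nat using (ℕ; zero; suc; _^_; _∸_)
import Data.Nat as ℕ
open import Data.Fin using (Fin)
import Data.Fin as Fin
open import Data.Product using (Σ; ∃; _×_; _,_)
open import Relation.Nullary using (¬_)
open import Relation.Binary.Definitions using (Decidable)
open import Relation.Binary.PropositionalEquality using (_≡_)
open import Relation.Unary using (Pred)

-- q-analogue  [s]_q = (q^s - 1)/(q - 1) = 1 + q + ... + q^(s-1),  [0]_q = 0.
[_]_ : ℕ → ℕ → ℕ
[ zero  ] q = 0
[ suc s ] q = q ^ s ℕ.+ [ s ] q

HasExactly : ∀ {p} {n : ℕ} → (Fin n → Set p) → ℕ → Set p
HasExactly {n = n} P N =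
  Σ (Fin N → Fin n) λ f →
    (∀ a → P (f a)) ×
    (∀ a b → f a ≡ f b → a ≡ b) ×
    (∀ j → P j → ∃ λ a → f a ≡ j)

record IsDiscreteField {c ℓ} (R : CommutativeRing c ℓ) : Set (c ⊔ ℓ) where
  open CommutativeRing R
  field
    _≟_     : Decidable _≈_
    1≉0     : ¬ (1# ≈ 0#)
    inverse : ∀ x → ¬ (x ≈ 0#) → ∃ λ y → x * y ≈ 1#

record HasSize {c ℓ} (R : CommutativeRing c ℓ) (q : ℕ) : Set (c ⊔ ℓ) where
  open CommutativeRing R
  field
    enum      : Fin q → Carrier
    enum-inj  : ∀ a b → enum a ≈ enum b → a ≡ b
    enum-surj : ∀ x → ∃ λ a → enum a ≈ x

module LinAlg {c ℓ} (R : CommutativeRing c ℓ) where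
  open CommutativeRing R

  Vector : ℕ → Set c
  Vector n = Fin n → Carrier

  Matrix : ℕ → ℕ → Set c
  Matrix r n = Fin r → Fin n → Carrier

  ∑ : ∀ {r} → (Fin r → Carrier) → Carrier
  ∑ {zero}  f = 0#
  ∑ {suc r} f = f Fin.zero + ∑ (λ i → f (Fin.suc i))

  column : ∀ {r n} → Matrix r n → Fin n → Vector r
  column M j i = M i j

  IsZeroVector : ∀ {r} → Vector r → Set ℓ
  IsZeroVector u = ∀ i → u i ≈ 0#

  Proportional : ∀ {r} → Vector r → Vector r → Set (c ⊔ ℓ)
  Proportional u v = ∃ λ a → ¬ (a ≈ 0#) × (∀ i → u i ≈ a * v i)

  InRowSpace : ∀ {r n} → Matrix r n → Vector n → Set (c ⊔ ℓ)
  InRowSpace M v = ∃ λ (coef : Fin _ → Carrier) → ∀ j → v j ≈ ∑ (λ i → coef i * M i j)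

  RowsIndependent : ∀ {r n} → Matrix r n → Set (c ⊔ ℓ)
  RowsIndependent M = ∀ (coef : Fin _ → Carrier) →
    (∀ j → ∑ (λ i → coef i * M i j) ≈ 0#) → ∀ i → coef i ≈ 0#

  IsGeneratorMatrix : ∀ {p r n} → Pred (Vector n) p → Matrix r n → Set (c ⊔ ℓ ⊔ p)
  IsGeneratorMatrix X M =
    RowsIndependent M × (∀ v → X v → InRowSpace M v) × (∀ v → InRowSpace M v → X v)

  IsSubspaceOfDim : ∀ {p n} → Pred (Vector n) p → ℕ → Set (c ⊔ ℓ ⊔ p)
  IsSubspaceOfDim {n = n} X m = Σ (Matrix m n) (IsGeneratorMatrix X)

  IsSimplexCode : ∀ {p n} → ℕ → Pred (Vector n) p → Set (c ⊔ ℓ ⊔ p)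
  IsSimplexCode {n = n} k C =
    Σ (Matrix k n) λ G → IsGeneratorMatrix C G ×
      (∀ j → ¬ IsZeroVector (column G j)) ×
      (∀ j j' → ¬ (j ≡ j') → ¬ Proportional (column G j) (column G j'))

  ContainedInSimplexCode : ∀ {p n} → ℕ → Pred (Vector n) p → Set (c ⊔ ℓ ⊔ lsuc p)
  ContainedInSimplexCode {p} {n} k X =
    Σ (Pred (Vector n) p) λ C → IsSimplexCode k C × (∀ v → X v → C v)

  Star : ∀ {m n} → ℕ → ℕ → Matrix m n → Set (c ⊔ ℓ)
  Star {m} q k M =
    HasExactly (λ j → IsZeroVector (column M j)) ([ k ∸ m ] q) ×
    (∀ j → ¬ IsZeroVector (column M j) →
       HasExactly (λ j' → Proportional (column M j') (column M j)) (q ^ (k ∸ m)))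

{-# OPTIONS --safe #-}
module Submission where

-- The non-zero multiples of the columns gⱼ of a simplex generator matrix G list every non-zero
-- vector of F^k exactly once.  A generator matrix of X ⊆ C is M = A G with A of rank m, so the
-- columns of M are the A gⱼ, and counting columns of M with a property stable under non-zero
-- scaling amounts to counting vectors u of F^k: zero columns come from ker A ∖ {0}, and columns
-- proportional to a non-zero column v from the cosets A⁻¹(t v), t ≠ 0.  Both counts follow from
-- |ker A| = q^(k-m), obtained by double counting the pairs (c, u) with c · A u = 0.  Conversely,
-- stacking d = k - m suitable rows under M turns it into a simplex generator matrix whose row
-- space contains X.

open import Defs
open import Level using (Level; _⊔_)
open import Algebra.Bundles using (CommutativeRing)
open import Data.Nat using (ℕ; _≤_)
open import Data.Product using (_×_; _,_)
open import Relation.Unary using (Pred)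

module Counting where
  open import Data.Nat using (zero; suc; _+_; _*_; z≤n; s≤s)
  open import Data.Nat.Properties hiding (suc-injective)
  open import Data.Fin using (Fin; zero; suc; _↑ˡ_; _↑ʳ_; combine; remQuot; punchOut)
  open import Data.Fin.Properties using (injective⇒≤; punchOut-injective; any?; suc-injective; remQuot-combine)
  import Data.Fin.Properties as Fin
  open import Data.Maybe using (Maybe; just; nothing; fromMaybe)
  import Data.Maybe as Maybe
  open import Data.Product using (∃; proj₁; proj₂)
  open import Data.Empty using (⊥-elim)
  open import Function using (_∘_)
  open import Relation.Nullary using (¬_; Dec; yes; no; ¬?; _×-dec_)
  open import Relation.Binary.PropositionalEquality
  open ≡-Reasoning
  open import Algebra.Properties.Semiring.Sum +-*-semiring public
    using () renaming ( sum to Σℕ; sum-cong-≗ to Σℕ-cong; ∑-distrib-+ to Σℕ-+; ∑-comm to Σℕ-comm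
                      ; *-distribˡ-sum to *-distribˡ-Σℕ)

  private variable
    p p′ : Level
    m n : ℕ

  Σℕ-const : ∀ n (c : ℕ) → Σℕ {n} (λ _ → c) ≡ n * c
  Σℕ-const zero    c = refl
  Σℕ-const (suc n) c = cong (c +_) (Σℕ-const n c)

  Σℕ-*ʳ : ∀ (c : ℕ) (f : Fin n → ℕ) → Σℕ (λ i → f i * c) ≡ Σℕ f * c
  Σℕ-*ʳ {n} c f = begin
    Σℕ (λ i → f i * c) ≡⟨ Σℕ-cong (λ i → *-comm (f i) c) ⟩
    Σℕ (λ i → c * f i) ≡⟨ *-distribˡ-Σℕ c f ⟨
    c * Σℕ f           ≡⟨ *-comm c (Σℕ f) ⟩
    Σℕ f * c           ∎

  Σℕ-split : ∀ m (f : Fin (m + n) → ℕ) →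
    Σℕ f ≡ Σℕ (λ i → f (i ↑ˡ n)) + Σℕ (λ i → f (m ↑ʳ i))
  Σℕ-split zero    f = refl
  Σℕ-split (suc m) f = trans (cong (f zero +_) (Σℕ-split m (λ i → f (suc i)))) (sym (+-assoc (f zero) _ _))

  Σℕ-combine : ∀ m (f : Fin (m * n) → ℕ) → Σℕ f ≡ Σℕ (λ i → Σℕ (λ j → f (combine {m} {n} i j)))
  Σℕ-combine zero    f = refl
  Σℕ-combine {n} (suc m) f =
    trans (Σℕ-split n f) (cong (Σℕ (λ j → f (j ↑ˡ (m * n))) +_) (Σℕ-combine m (λ x → f (n ↑ʳ x))))

  Σℕ-remQuot : ∀ m (f : Fin m → Fin n → ℕ) →
    Σℕ (λ x → f (proj₁ (remQuot {m} n x)) (proj₂ (remQuot {m} n x))) ≡ Σℕ (λ i → Σℕ (f i))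
  Σℕ-remQuot m f = trans (Σℕ-combine m _)
    (Σℕ-cong (λ i → Σℕ-cong (λ j → cong (λ x → f (proj₁ x) (proj₂ x)) (remQuot-combine i j))))

  χ : ∀ {A : Set p} → Dec A → ℕ
  χ (yes _) = 1
  χ (no _)  = 0

  count : ∀ {P : Fin n → Set p} → (∀ i → Dec (P i)) → ℕ
  count P? = Σℕ (λ i → χ (P? i))

  χ-cong : ∀ {A : Set p} {B : Set p′} (A? : Dec A) (B? : Dec B) → (A → B) → (B → A) → χ A? ≡ χ B?
  χ-cong (yes _) (yes _) _   _   = refl
  χ-cong (yes a) (no ¬b) A→B _   = ⊥-elim (¬b (A→B a))
  χ-cong (no ¬a) (yes b) _   B→A = ⊥-elim (¬a (B→A b))
  χ-cong (no _)  (no _)  _   _   = refl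

  χ-× : ∀ {A : Set p} {B : Set p′} (A? : Dec A) (B? : Dec B) → χ (A? ×-dec B?) ≡ χ A? * χ B?
  χ-× (yes _) (yes _) = refl
  χ-× (yes _) (no _)  = refl
  χ-× (no _)  _       = refl

  χ-split : ∀ {A : Set p} {B : Set p′} (A? : Dec A) (B? : Dec B) →
    χ A? ≡ χ (A? ×-dec B?) + χ (A? ×-dec ¬? B?)
  χ-split (yes _) (yes _) = refl
  χ-split (yes _) (no _)  = refl
  χ-split (no _)  (yes _) = refl
  χ-split (no _)  (no _)  = refl

  χ-¬ : ∀ {A : Set p} (A? : Dec A) → χ A? + χ (¬? A?) ≡ 1
  χ-¬ (yes _) = refl
  χ-¬ (no _)  = refl

  module _ {P : Fin n → Set p} (P? : ∀ i → Dec (P i)) where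

    count-cong : ∀ {Q : Fin n → Set p′} (Q? : ∀ i → Dec (Q i)) →
      (∀ i → P i → Q i) → (∀ i → Q i → P i) → count P? ≡ count Q?
    count-cong Q? P⇒Q Q⇒P = Σℕ-cong (λ i → χ-cong (P? i) (Q? i) (P⇒Q i) (Q⇒P i))

    count-split : ∀ {Q : Fin n → Set p′} (Q? : ∀ i → Dec (Q i)) →
      count P? ≡ count (λ i → P? i ×-dec Q? i) + count (λ i → P? i ×-dec ¬? (Q? i))
    count-split Q? = trans (Σℕ-cong (λ i → χ-split (P? i) (Q? i)))
      (Σℕ-+ (λ i → χ (P? i ×-dec Q? i)) (λ i → χ (P? i ×-dec ¬? (Q? i))))

    count-complement : count P? + count (λ i → ¬? (P? i)) ≡ n
    count-complement = begin
      count P? + count (λ i → ¬? (P? i)) ≡⟨ Σℕ-+ (λ i → χ (P? i)) (λ i → χ (¬? (P? i))) ⟨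
      Σℕ (λ i → χ (P? i) + χ (¬? (P? i))) ≡⟨ Σℕ-cong (λ i → χ-¬ (P? i)) ⟩
      Σℕ {n} (λ _ → 1)                    ≡⟨ Σℕ-const n 1 ⟩
      n * 1                               ≡⟨ *-identityʳ n ⟩
      n                                   ∎

    count-all : (∀ i → P i) → count P? ≡ n
    count-all all-P = trans (Σℕ-cong (λ i → χ-yes (P? i) (all-P i))) (trans (Σℕ-const n 1) (*-identityʳ n))
      where
      χ-yes : ∀ {A : Set p} (A? : Dec A) → A → χ A? ≡ 1
      χ-yes (yes _) _ = refl
      χ-yes (no ¬a) a = ⊥-elim (¬a a)

    count-none : (∀ i → ¬ P i) → count P? ≡ 0
    count-none none-P = trans (Σℕ-cong (λ i → χ-no (P? i) (none-P i))) (trans (Σℕ-const n 0) (*-zeroʳ n))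
      where
      χ-no : ∀ {A : Set p} (A? : Dec A) → ¬ A → χ A? ≡ 0
      χ-no (yes a) ¬a = ⊥-elim (¬a a)
      χ-no (no _)  _  = refl

    Σℕ-two-valued : ∀ (f : Fin n → ℕ) a b → (∀ i → P i → f i ≡ a) → (∀ i → ¬ P i → f i ≡ b) →
      Σℕ f ≡ count P? * a + count (λ i → ¬? (P? i)) * b
    Σℕ-two-valued f a b f≡a f≡b = begin
      Σℕ f                                                ≡⟨ Σℕ-cong (λ i → value (P? i) (f≡a i) (f≡b i)) ⟩
      Σℕ (λ i → χ (P? i) * a + χ (¬? (P? i)) * b)         ≡⟨ Σℕ-+ (λ i → χ (P? i) * a) (λ i → χ (¬? (P? i)) * b) ⟩
      Σℕ (λ i → χ (P? i) * a) + Σℕ (λ i → χ (¬? (P? i)) * b)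
                                                          ≡⟨ cong₂ _+_ (Σℕ-*ʳ a (λ i → χ (P? i))) (Σℕ-*ʳ b (λ i → χ (¬? (P? i)))) ⟩
      count P? * a + count (λ i → ¬? (P? i)) * b          ∎
      where
      value : ∀ {A : Set p} {x} (A? : Dec A) → (A → x ≡ a) → (¬ A → x ≡ b) → x ≡ χ A? * a + χ (¬? A?) * b
      value (yes p) x≡a _ = trans (x≡a p) (sym (trans (+-identityʳ (a + 0)) (+-identityʳ a)))
      value (no ¬p) _ x≡b = trans (x≡b ¬p) (sym (+-identityʳ b))

  count-×ˡ : ∀ {A : Set p} (A? : Dec A) {Q : Fin n → Set p′} (Q? : ∀ i → Dec (Q i)) →
    count (λ i → A? ×-dec Q? i) ≡ χ A? * count Q?
  count-×ˡ A? Q? = trans (Σℕ-cong (λ i → χ-× A? (Q? i))) (sym (*-distribˡ-Σℕ (χ A?) (λ i → χ (Q? i))))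

  count-hasExactly : ∀ {P : Fin n → Set p} (P? : ∀ i → Dec (P i)) → HasExactly P (count P?)
  count-hasExactly {zero}  P? = (λ ()) , (λ ()) , (λ ()) , (λ ())
  count-hasExactly {suc n} {P = P} P? with P? zero | count-hasExactly (λ i → P? (suc i))
  ... | yes p₀ | f , f-P , f-inj , f-onto = g , g-P , g-inj , g-onto
    where
    g : Fin (suc (count (λ i → P? (suc i)))) → Fin (suc n)
    g zero    = zero
    g (suc a) = suc (f a)
    g-P : ∀ a → P (g a)
    g-P zero    = p₀
    g-P (suc a) = f-P a
    g-inj : ∀ a b → g a ≡ g b → a ≡ b
    g-inj zero    zero    _  = refl
    g-inj (suc a) (suc b) eq = cong suc (f-inj a b (suc-injective eq))
    g-onto : ∀ j → P j → ∃ λ a → g a ≡ j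
    g-onto zero    _  = zero , refl
    g-onto (suc j) pj = let a , eq = f-onto j pj in suc a , cong suc eq
  ... | no ¬p₀ | f , f-P , f-inj , f-onto =
    (λ a → suc (f a)) , f-P , (λ a b eq → f-inj a b (suc-injective eq)) , g-onto
    where
    g-onto : ∀ j → P j → ∃ λ a → suc (f a) ≡ j
    g-onto zero    pj = ⊥-elim (¬p₀ pj)
    g-onto (suc j) pj = let a , eq = f-onto j pj in a , cong suc eq

  hasExactly-≤ : ∀ {P : Fin n → Set p} {a b} → HasExactly P a → HasExactly P b → a ≤ b
  hasExactly-≤ {a = a} {b} (f , f-P , f-inj , _) (g , _ , _ , g-onto) =
    injective⇒≤ {f = h} (λ {x} {y} eq → f-inj x y (trans (sym (g∘h x)) (trans (cong g eq) (g∘h y))))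
    where
    h : Fin a → Fin b
    h x = proj₁ (g-onto (f x) (f-P x))
    g∘h : ∀ x → g (h x) ≡ f x
    g∘h x = proj₂ (g-onto (f x) (f-P x))

  hasExactly-unique : ∀ {P : Fin n → Set p} {a b} → HasExactly P a → HasExactly P b → a ≡ b
  hasExactly-unique hₐ h_b = ≤-antisym (hasExactly-≤ hₐ h_b) (hasExactly-≤ h_b hₐ)

  count-≡ : ∀ {P : Fin n → Set p} (P? : ∀ i → Dec (P i)) {a} → HasExactly P a → count P? ≡ a
  count-≡ P? = hasExactly-unique (count-hasExactly P?)

  count-one : ∀ {P : Fin n → Set p} (P? : ∀ i → Dec (P i)) x → P x → (∀ y → P y → y ≡ x) → count P? ≡ 1
  count-one P? x px unique =
    count-≡ P? ((λ _ → x) , (λ _ → px) , (λ { zero zero _ → refl }) , λ j pj → zero , sym (unique j pj))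

  count-positive : ∀ {P : Fin n → Set p} (P? : ∀ i → Dec (P i)) x → P x → 1 ≤ count P?
  count-positive P? zero px with P? zero
  ... | yes _  = s≤s z≤n
  ... | no ¬p  = ⊥-elim (¬p px)
  count-positive P? (suc x) px = ≤-trans (count-positive (λ i → P? (suc i)) x px) (m≤n+m _ (χ (P? zero)))

  injective⇒onto : ∀ (ψ : Fin n → Fin n) → (∀ a b → ψ a ≡ ψ b → a ≡ b) → ∀ t → ∃ λ a → ψ a ≡ t
  injective⇒onto {suc n} ψ ψ-inj t with any? (λ a → ψ a Fin.≟ t)
  ... | yes hit = hit
  ... | no miss = ⊥-elim (1+n≰n (injective⇒≤ {f = ψ′} (λ {x} {y} eq → ψ-inj x y (punchOut-injective (t≢ψ x) (t≢ψ y) eq))))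
    where
    t≢ψ : ∀ a → t ≢ ψ a
    t≢ψ a eq = miss (a , sym eq)
    ψ′ : Fin (suc n) → Fin n
    ψ′ a = punchOut (t≢ψ a)

  module _ {n n′} {P : Fin n → Set p} {P′ : Fin n′ → Set p′}
           (P? : ∀ i → Dec (P i)) (P′? : ∀ i → Dec (P′ i)) (φ : Fin n → Fin n′)
           (φ-P : ∀ x → P x → P′ (φ x)) (φ-inj : ∀ x y → P x → P y → φ x ≡ φ y → x ≡ y) where

    count-bijection : (∀ y → P′ y → ∃ λ x → P x × φ x ≡ y) → count P? ≡ count P′?
    count-bijection φ-onto with count-hasExactly P?
    ... | f , f-P , f-inj , f-onto = sym (count-≡ P′? (φ ∘ f , φf-P , φf-inj , φf-onto))
      where
      φf-P : ∀ a → P′ (φ (f a))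
      φf-P a = φ-P (f a) (f-P a)
      φf-inj : ∀ a b → φ (f a) ≡ φ (f b) → a ≡ b
      φf-inj a b eq = f-inj a b (φ-inj (f a) (f b) (f-P a) (f-P b) eq)
      φf-onto : ∀ y → P′ y → ∃ λ a → φ (f a) ≡ y
      φf-onto y p′y with φ-onto y p′y
      ... | x , px , φx≡y with f-onto x px
      ... | a , fa≡x = a , trans (cong φ fa≡x) φx≡y

    equal-count⇒onto : count P? ≡ count P′? → ∀ y → P′ y → ∃ λ x → P x × φ x ≡ y
    equal-count⇒onto counts-equal y p′y
      with count-hasExactly P? | subst (HasExactly P′) (sym counts-equal) (count-hasExactly P′?)
    ... | f , f-P , f-inj , _ | g , _ , g-inj , g-onto = f a , f-P a , φfa≡y
      where
      h : Fin (count P?) → Fin (count P?)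
      h x = proj₁ (g-onto (φ (f x)) (φ-P (f x) (f-P x)))
      g∘h : ∀ x → g (h x) ≡ φ (f x)
      g∘h x = proj₂ (g-onto (φ (f x)) (φ-P (f x) (f-P x)))
      h-inj : ∀ a b → h a ≡ h b → a ≡ b
      h-inj a b eq = f-inj a b (φ-inj (f a) (f b) (f-P a) (f-P b)
        (trans (sym (g∘h a)) (trans (cong g eq) (g∘h b))))
      t : Fin (count P?)
      t = proj₁ (g-onto y p′y)
      a : Fin (count P?)
      a = proj₁ (injective⇒onto h h-inj t)
      φfa≡y : φ (f a) ≡ y
      φfa≡y = begin
        φ (f a)  ≡⟨ g∘h a ⟨
        g (h a)  ≡⟨ cong g (proj₂ (injective⇒onto h h-inj t)) ⟩
        g t      ≡⟨ proj₂ (g-onto y p′y) ⟩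
        y        ∎

  search : ∀ {P : Fin n → Set p} → (∀ i → Dec (P i)) → Maybe (Fin n)
  search {zero}  P? = nothing
  search {suc n} P? with P? zero
  ... | yes _ = just zero
  ... | no _  = Maybe.map suc (search (λ i → P? (suc i)))

  search-just : ∀ {P : Fin n → Set p} (P? : ∀ i → Dec (P i)) y → search P? ≡ just y → P y
  search-just {suc n} P? y eq with P? zero
  search-just {suc n} P? zero refl | yes p = p
  ... | no _ with search (λ i → P? (suc i)) in eq′
  search-just {suc n} P? (suc y) refl | no _ | just y = search-just (λ i → P? (suc i)) y eq′

  search-nothing : ∀ {P : Fin n → Set p} (P? : ∀ i → Dec (P i)) → search P? ≡ nothing → ∀ x → ¬ P x
  search-nothing {suc n} P? eq x px with P? zero
  search-nothing {suc n} P? () x px | yes _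
  search-nothing {suc n} P? eq zero px | no ¬p = ¬p px
  search-nothing {suc n} P? eq (suc x) px | no ¬p with search (λ i → P? (suc i)) in eq′
  search-nothing {suc n} P? refl (suc x) px | no ¬p | nothing = search-nothing (λ i → P? (suc i)) eq′ x px

  search-cong : ∀ {P : Fin n → Set p} {Q : Fin n → Set p′} (P? : ∀ i → Dec (P i)) (Q? : ∀ i → Dec (Q i)) →
    (∀ i → P i → Q i) → (∀ i → Q i → P i) → search P? ≡ search Q?
  search-cong {zero}  P? Q? P⇒Q Q⇒P = refl
  search-cong {suc n} P? Q? P⇒Q Q⇒P with P? zero | Q? zero
  ... | yes _ | yes _  = refl
  ... | yes p | no ¬q  = ⊥-elim (¬q (P⇒Q zero p))
  ... | no ¬p | yes q  = ⊥-elim (¬p (Q⇒P zero q))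
  ... | no _  | no _   = cong (Maybe.map suc)
    (search-cong (λ i → P? (suc i)) (λ i → Q? (suc i)) (λ i → P⇒Q (suc i)) (λ i → Q⇒P (suc i)))

  least : ∀ {P : Fin n → Set p} → (∀ i → Dec (P i)) → Fin n → Fin n
  least P? x = fromMaybe x (search P?)

  least-P : ∀ {P : Fin n → Set p} (P? : ∀ i → Dec (P i)) x → P x → P (least P? x)
  least-P P? x px with search P? in eq
  ... | just y  = search-just P? y eq
  ... | nothing = px

  least-cong : ∀ {P : Fin n → Set p} {Q : Fin n → Set p′} (P? : ∀ i → Dec (P i)) (Q? : ∀ i → Dec (Q i)) →
    (∀ i → P i → Q i) → (∀ i → Q i → P i) → ∀ x y → P x → least P? x ≡ least Q? y
  least-cong P? Q? P⇒Q Q⇒P x y px rewrite search-cong P? Q? P⇒Q Q⇒P with search Q? in eq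
  ... | just z  = refl
  ... | nothing = ⊥-elim (search-nothing Q? eq x (P⇒Q x px))

module Arithmetic where
  open import Data.Nat
  open import Data.Nat.Properties
  open import Data.Nat.Tactic.RingSolver using (solve-∀)
  open import Relation.Binary.PropositionalEquality hiding ([_])
  open ≡-Reasoning

  []-geometric : ∀ r s → [ s ] (suc r) * r + 1 ≡ suc r ^ s
  []-geometric r zero    = refl
  []-geometric r (suc s) = begin
    (suc r ^ s + [ s ] (suc r)) * r + 1     ≡⟨ regroup r (suc r ^ s) ([ s ] (suc r)) ⟩
    suc r ^ s * r + ([ s ] (suc r) * r + 1) ≡⟨ cong (suc r ^ s * r +_) ([]-geometric r s) ⟩
    suc r ^ s * r + suc r ^ s               ≡⟨ factor r (suc r ^ s) ⟩
    suc r * suc r ^ s                       ∎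
    where
    regroup : ∀ r a b → (a + b) * r + 1 ≡ a * r + (b * r + 1)
    regroup = solve-∀
    factor : ∀ r a → a * r + a ≡ suc r * a
    factor = solve-∀

  ^-quotient : ∀ b m k Z → m ≤ k → suc b ^ k ≡ Z * suc b ^ m → Z ≡ suc b ^ (k ∸ m)
  ^-quotient b m k Z m≤k eq = *-cancelʳ-≡ Z (suc b ^ (k ∸ m)) (suc b ^ m) {{m^n≢0 (suc b) m}} (begin
    Z * suc b ^ m               ≡⟨ eq ⟨
    suc b ^ k                   ≡⟨ cong (suc b ^_) (m∸n+n≡m m≤k) ⟨
    suc b ^ (k ∸ m + m)         ≡⟨ ^-distribˡ-+-* (suc b) (k ∸ m) m ⟩
    suc b ^ (k ∸ m) * suc b ^ m ∎)

  -- The hypothesis says (q ∸ 1)·W = (q ∸ 1)·Z·N.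
  double-count-cancel : ∀ q N Z W → 2 ≤ q →
    q * (Z + W) + N * (Z + W) ≡ Z * (q * suc N) + W * suc N → Z + W ≡ Z * suc N
  double-count-cancel .(suc (suc r)) N Z W (s≤s (s≤s {n = r} z≤n)) eq =
    *-cancelˡ-≡ (Z + W) (Z * suc N) (suc r) (+-cancelʳ-≡ ((Z + W) * suc N) _ _ (begin
      suc r * (Z + W) + (Z + W) * suc N                     ≡⟨ lhs r N Z W ⟩
      suc (suc r) * (Z + W) + N * (Z + W)                   ≡⟨ eq ⟩
      Z * (suc (suc r) * suc N) + W * suc N                 ≡⟨ rhs r N Z W ⟩
      suc r * (Z * suc N) + (Z + W) * suc N                 ∎))
    where
    lhs : ∀ r N Z W → suc r * (Z + W) + (Z + W) * suc N ≡ suc (suc r) * (Z + W) + N * (Z + W)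
    lhs = solve-∀
    rhs : ∀ r N Z W → Z * (suc (suc r) * suc N) + W * suc N ≡ suc r * (Z * suc N) + (Z + W) * suc N
    rhs = solve-∀

module FiniteField {c ℓ} (F : CommutativeRing c ℓ) (isField : IsDiscreteField F) (q : ℕ) (size : HasSize F q) where
  open import Data.Nat using (zero; suc; _^_)
  import Data.Nat as ℕ
  import Data.Nat.Properties as ℕ
  open import Data.Fin as Fin using (Fin; zero; suc; combine; remQuot)
  import Data.Fin.Properties as Fin
  open import Data.Product using (∃; proj₁; proj₂)
  open import Data.Empty using (⊥-elim)
  open import Data.Sum using (_⊎_; inj₁; inj₂)
  open import Data.Vec.Functional using (_∷_; _++_)
  open import Data.Vec.Functional.Properties using (lookup-++ˡ; lookup-++ʳ)
  open import Relation.Nullary using (¬_; Dec; yes; no; ¬?; _×-dec_)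
  import Relation.Nullary.Decidable as Dec
  open import Relation.Binary.PropositionalEquality as ≡ using (_≡_; _≢_; module ≡-Reasoning)

  open CommutativeRing F hiding (zero)
  open IsDiscreteField isField
  open HasSize size
  open LinAlg F
  open import Algebra.Properties.Ring ring using (-1*x≈-x)
  open import Algebra.Properties.CommutativeSemigroup *-commutativeSemigroup using (x∙yz≈y∙xz)
  open import Algebra.Properties.Semiring.Sum semiring using (sum; sum-cong-≋; ∑-distrib-+; ∑-comm; *-distribˡ-sum; sum-replicate-zero)
  open import Data.Vec.Functional.Relation.Binary.Equality.Setoid setoid using (_≋_; ≋-sym; ≋-trans)
  import Relation.Binary.Reasoning.Setoid setoid as ≈-Reasoning
  open Counting
  open Arithmetic

  private variable
    r s m k : ℕ

  inv : ∀ x → x ≉ 0# → Carrier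
  inv x x≉0 = proj₁ (inverse x x≉0)

  inv-inverseʳ : ∀ x (x≉0 : x ≉ 0#) → x * inv x x≉0 ≈ 1#
  inv-inverseʳ x x≉0 = proj₂ (inverse x x≉0)

  inv-inverseˡ : ∀ x (x≉0 : x ≉ 0#) → inv x x≉0 * x ≈ 1#
  inv-inverseˡ x x≉0 = trans (*-comm _ _) (inv-inverseʳ x x≉0)

  inv-cancelˡ : ∀ a (a≉0 : a ≉ 0#) y → inv a a≉0 * (a * y) ≈ y
  inv-cancelˡ a a≉0 y = begin
    inv a a≉0 * (a * y) ≈⟨ *-assoc _ _ _ ⟨
    (inv a a≉0 * a) * y ≈⟨ *-congʳ (inv-inverseˡ a a≉0) ⟩
    1# * y              ≈⟨ *-identityˡ y ⟩
    y                   ∎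
    where open ≈-Reasoning

  *-cancelˡ-nonzero : ∀ a {x y} → a ≉ 0# → a * x ≈ a * y → x ≈ y
  *-cancelˡ-nonzero a {x} {y} a≉0 ax≈ay = begin
    x                   ≈⟨ inv-cancelˡ a a≉0 x ⟨
    inv a a≉0 * (a * x) ≈⟨ *-congˡ ax≈ay ⟩
    inv a a≉0 * (a * y) ≈⟨ inv-cancelˡ a a≉0 y ⟩
    y                   ∎
    where open ≈-Reasoning

  *-cancelʳ-nonzero : ∀ a {x y} → a ≉ 0# → x * a ≈ y * a → x ≈ y
  *-cancelʳ-nonzero a {x} {y} a≉0 xa≈ya = *-cancelˡ-nonzero a a≉0 (trans (*-comm a x) (trans xa≈ya (*-comm y a)))

  nonzero-*-zero : ∀ a {x} → a ≉ 0# → a * x ≈ 0# → x ≈ 0#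
  nonzero-*-zero a a≉0 ax≈0 = *-cancelˡ-nonzero a a≉0 (trans ax≈0 (sym (zeroʳ a)))

  *-nonzero : ∀ {a b} → a ≉ 0# → b ≉ 0# → a * b ≉ 0#
  *-nonzero {a} a≉0 b≉0 ab≈0 = b≉0 (nonzero-*-zero a a≉0 ab≈0)

  inv-nonzero : ∀ a (a≉0 : a ≉ 0#) → inv a a≉0 ≉ 0#
  inv-nonzero a a≉0 inv≈0 = 1≉0 (trans (sym (inv-inverseʳ a a≉0)) (trans (*-congˡ inv≈0) (zeroʳ a)))

  x+-1*x≈0 : ∀ x → x + - 1# * x ≈ 0#
  x+-1*x≈0 x = trans (+-congˡ (-1*x≈-x x)) (-‿inverseʳ x)

  ∑≈sum : ∀ (f : Fin r → Carrier) → ∑ f ≈ sum f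
  ∑≈sum {zero}  f = refl
  ∑≈sum {suc r} f = +-congˡ (∑≈sum (λ i → f (suc i)))

  ∑-cong : ∀ {f g : Fin r → Carrier} → (∀ i → f i ≈ g i) → ∑ f ≈ ∑ g
  ∑-cong {f = f} {g} f≈g = trans (∑≈sum f) (trans (sum-cong-≋ f≈g) (sym (∑≈sum g)))

  ∑-zero : ∀ (f : Fin r → Carrier) → (∀ i → f i ≈ 0#) → ∑ f ≈ 0#
  ∑-zero {r} f f≈0 = trans (∑-cong f≈0) (trans (∑≈sum {r} (λ _ → 0#)) (sum-replicate-zero r))

  ∑-+ : ∀ (f g : Fin r → Carrier) → ∑ (λ i → f i + g i) ≈ ∑ f + ∑ g
  ∑-+ f g = begin
    ∑ (λ i → f i + g i)   ≈⟨ ∑≈sum (λ i → f i + g i) ⟩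
    sum (λ i → f i + g i) ≈⟨ ∑-distrib-+ f g ⟩
    sum f + sum g         ≈⟨ +-cong (∑≈sum f) (∑≈sum g) ⟨
    ∑ f + ∑ g             ∎
    where open ≈-Reasoning

  ∑-*ˡ : ∀ a (f : Fin r → Carrier) → ∑ (λ i → a * f i) ≈ a * ∑ f
  ∑-*ˡ a f = begin
    ∑ (λ i → a * f i)   ≈⟨ ∑≈sum (λ i → a * f i) ⟩
    sum (λ i → a * f i) ≈⟨ *-distribˡ-sum a f ⟨
    a * sum f           ≈⟨ *-congˡ (∑≈sum f) ⟨
    a * ∑ f             ∎
    where open ≈-Reasoning

  ∑-*ʳ : ∀ a (f : Fin r → Carrier) → ∑ (λ i → f i * a) ≈ ∑ f * a
  ∑-*ʳ a f = trans (∑-cong (λ i → *-comm (f i) a)) (trans (∑-*ˡ a f) (*-comm a _))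

  ∑-swap : ∀ {m n} (f : Fin m → Fin n → Carrier) → ∑ (λ i → ∑ (f i)) ≈ ∑ (λ j → ∑ (λ i → f i j))
  ∑-swap f = begin
    ∑ (λ i → ∑ (f i))                 ≈⟨ trans (∑≈sum (λ i → ∑ (f i))) (sum-cong-≋ (λ i → ∑≈sum (f i))) ⟩
    sum (λ i → sum (f i))             ≈⟨ ∑-comm f ⟩
    sum (λ j → sum (λ i → f i j))     ≈⟨ trans (∑≈sum (λ j → ∑ (λ i → f i j))) (sum-cong-≋ (λ j → ∑≈sum (λ i → f i j))) ⟨
    ∑ (λ j → ∑ (λ i → f i j))         ∎
    where open ≈-Reasoning

  ∑-single : ∀ (f : Fin r → Carrier) l → (∀ i → i ≢ l → f i ≈ 0#) → ∑ f ≈ f l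
  ∑-single {suc r} f zero    f≈0 = trans (+-congˡ (∑-zero _ (λ i → f≈0 (suc i) λ ()))) (+-identityʳ _)
  ∑-single {suc r} f (suc l) f≈0 =
    trans (+-cong (f≈0 zero λ ()) (∑-single (λ i → f (suc i)) l (λ i i≢l → f≈0 (suc i) (λ eq → i≢l (Fin.suc-injective eq)))))
          (+-identityˡ _)

  ∑-++ : ∀ m {d} (f : Fin (m ℕ.+ d) → Carrier) → ∑ f ≈ ∑ (λ i → f (i Fin.↑ˡ d)) + ∑ (λ i → f (m Fin.↑ʳ i))
  ∑-++ zero    f = sym (+-identityˡ _)
  ∑-++ (suc m) f = trans (+-congˡ (∑-++ m (λ i → f (suc i)))) (sym (+-assoc _ _ _))

  infixl 6 _⊕_
  infixr 7 _⊙_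
  infix  7 _·_ _*ᵥ_ _ᵥ*_
  infix  4 _∝_

  _⊕_ : Vector r → Vector r → Vector r
  (u ⊕ v) i = u i + v i

  _⊙_ : Carrier → Vector r → Vector r
  (a ⊙ u) i = a * u i

  0ᵥ : Vector r
  0ᵥ _ = 0#

  _·_ : Vector r → Vector r → Carrier
  u · v = ∑ (λ i → u i * v i)

  _*ᵥ_ : Matrix m k → Vector k → Vector m
  (A *ᵥ u) i = A i · u

  _ᵥ*_ : Vector m → Matrix m k → Vector k
  (c ᵥ* A) l = ∑ (λ i → c i * A i l)

  single : Fin r → Carrier → Vector r
  single l a i with i Fin.≟ l
  ... | yes _ = a
  ... | no _  = 0#

  _∝_ : Vector r → Vector r → Set (c ⊔ ℓ)
  _∝_ = Proportional

  single-≡ : ∀ (l : Fin r) a → single l a l ≈ a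
  single-≡ l a with l Fin.≟ l
  ... | yes _ = refl
  ... | no l≢l = ⊥-elim (l≢l ≡.refl)

  single-≢ : ∀ {l i : Fin r} a → i ≢ l → single l a i ≈ 0#
  single-≢ {l = l} {i} a i≢l with i Fin.≟ l
  ... | yes i≡l = ⊥-elim (i≢l i≡l)
  ... | no _    = refl

  ·-single : ∀ (y : Vector r) l a → y · single l a ≈ y l * a
  ·-single y l a = trans (∑-single _ l (λ i i≢l → trans (*-congˡ (single-≢ a i≢l)) (zeroʳ _))) (*-congˡ (single-≡ l a))

  ·-congˡ : ∀ (y : Vector r) {u v} → u ≋ v → y · u ≈ y · v
  ·-congˡ y u≋v = ∑-cong (λ i → *-congˡ (u≋v i))

  ·-comm : ∀ (u v : Vector r) → u · v ≈ v · u
  ·-comm u v = ∑-cong (λ i → *-comm (u i) (v i))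

  ·-⊕ : ∀ (y u v : Vector r) → y · (u ⊕ v) ≈ y · u + y · v
  ·-⊕ y u v = trans (∑-cong (λ i → distribˡ (y i) (u i) (v i))) (∑-+ (λ i → y i * u i) (λ i → y i * v i))

  ·-⊙ : ∀ (y u : Vector r) a → y · (a ⊙ u) ≈ a * (y · u)
  ·-⊙ y u a = trans (∑-cong (λ i → x∙yz≈y∙xz (y i) a (u i))) (∑-*ˡ a (λ i → y i * u i))

  ·-zeroˡ : ∀ {u : Vector r} (y : Vector r) → IsZeroVector y → y · u ≈ 0#
  ·-zeroˡ y y≈0 = ∑-zero _ (λ i → trans (*-congʳ (y≈0 i)) (zeroˡ _))

  ·-zeroʳ : ∀ (y : Vector r) {u} → IsZeroVector u → y · u ≈ 0#
  ·-zeroʳ y u≈0 = ∑-zero _ (λ i → trans (*-congˡ (u≈0 i)) (zeroʳ _))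

  *ᵥ-congˡ : ∀ (A : Matrix m k) {u v} → u ≋ v → A *ᵥ u ≋ A *ᵥ v
  *ᵥ-congˡ A u≋v i = ·-congˡ (A i) u≋v

  *ᵥ-⊕ : ∀ (A : Matrix m k) u v → A *ᵥ (u ⊕ v) ≋ A *ᵥ u ⊕ A *ᵥ v
  *ᵥ-⊕ A u v i = ·-⊕ (A i) u v

  *ᵥ-⊙ : ∀ (A : Matrix m k) u a → A *ᵥ (a ⊙ u) ≋ a ⊙ (A *ᵥ u)
  *ᵥ-⊙ A u a i = ·-⊙ (A i) u a

  *ᵥ-zero : ∀ (A : Matrix m k) {u} → IsZeroVector u → IsZeroVector (A *ᵥ u)
  *ᵥ-zero A u≈0 i = ·-zeroʳ (A i) u≈0

  ·-*ᵥ : ∀ (c : Vector m) (A : Matrix m k) u → c · (A *ᵥ u) ≈ (c ᵥ* A) · u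
  ·-*ᵥ c A u = begin
    ∑ (λ i → c i * ∑ (λ l → A i l * u l))   ≈⟨ ∑-cong (λ i → sym (∑-*ˡ (c i) (λ l → A i l * u l))) ⟩
    ∑ (λ i → ∑ (λ l → c i * (A i l * u l))) ≈⟨ ∑-swap (λ i l → c i * (A i l * u l)) ⟩
    ∑ (λ l → ∑ (λ i → c i * (A i l * u l))) ≈⟨ ∑-cong (λ l → trans (∑-cong (λ i → sym (*-assoc (c i) (A i l) (u l))))
                                                                  (∑-*ʳ (u l) (λ i → c i * A i l))) ⟩
    ∑ (λ l → (c ᵥ* A) l * u l)              ∎
    where open ≈-Reasoning

  ∝-refl : ∀ (u : Vector r) → u ∝ u
  ∝-refl u = 1# , 1≉0 , λ i → sym (*-identityˡ _)

  ∝-sym : ∀ {u v : Vector r} → u ∝ v → v ∝ u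
  ∝-sym {u = u} {v} (a , a≉0 , u≈av) = inv a a≉0 , inv-nonzero a a≉0 , λ i → begin
    v i                   ≈⟨ inv-cancelˡ a a≉0 (v i) ⟨
    inv a a≉0 * (a * v i) ≈⟨ *-congˡ (u≈av i) ⟨
    inv a a≉0 * u i       ∎
    where open ≈-Reasoning

  ∝-trans : ∀ {u v w : Vector r} → u ∝ v → v ∝ w → u ∝ w
  ∝-trans (a , a≉0 , u≈av) (b , b≉0 , v≈bw) =
    a * b , *-nonzero a≉0 b≉0 , λ i → trans (u≈av i) (trans (*-congˡ (v≈bw i)) (sym (*-assoc _ _ _)))

  ∝-nonzero : ∀ {u v : Vector r} → u ∝ v → ¬ IsZeroVector u → ¬ IsZeroVector v
  ∝-nonzero (a , _ , u≈av) u≉0 v≈0 = u≉0 (λ i → trans (u≈av i) (trans (*-congˡ (v≈0 i)) (zeroʳ a)))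

  ∝-zero : ∀ {u v : Vector r} → u ∝ v → IsZeroVector u → IsZeroVector v
  ∝-zero (a , a≉0 , u≈av) u≈0 i = nonzero-*-zero a a≉0 (trans (sym (u≈av i)) (u≈0 i))

  zero? : (u : Vector r) → Dec (IsZeroVector u)
  zero? u = Fin.all? (λ i → u i ≟ 0#)

  _≋?_ : (u v : Vector r) → Dec (u ≋ v)
  u ≋? v = Fin.all? (λ i → u i ≟ v i)

  nonzero-entry : ∀ (u : Vector r) → ¬ IsZeroVector u → ∃ λ i → u i ≉ 0#
  nonzero-entry {r} u = Fin.¬∀⟶∃¬ r (λ i → u i ≈ 0#) (λ i → u i ≟ 0#)

  enum⁻¹ : Carrier → Fin q
  enum⁻¹ x = proj₁ (enum-surj x)

  enum-enum⁻¹ : ∀ x → enum (enum⁻¹ x) ≈ x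
  enum-enum⁻¹ x = proj₂ (enum-surj x)

  enum⁻¹-unique : ∀ {x} a → enum a ≈ x → a ≡ enum⁻¹ x
  enum⁻¹-unique {x} a a↦x = enum-inj a (enum⁻¹ x) (trans a↦x (sym (enum-enum⁻¹ x)))

  _∝?_ : (u v : Vector r) → Dec (u ∝ v)
  u ∝? v = Dec.map′ (λ (a , a≉0 , u≈av) → enum a , a≉0 , u≈av) from
    (Fin.any? (λ a → ¬? (enum a ≟ 0#) ×-dec (u ≋? (enum a ⊙ v))))
    where
    from : u ∝ v → ∃ λ a → enum a ≉ 0# × u ≋ enum a ⊙ v
    from (x , x≉0 , u≈xv) = enum⁻¹ x , (λ a≈0 → x≉0 (trans (sym (enum-enum⁻¹ x)) a≈0)) ,
      λ i → trans (u≈xv i) (*-congʳ (sym (enum-enum⁻¹ x)))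

  unit? : ∀ a → Dec (enum a ≉ 0#)
  unit? a = ¬? (enum a ≟ 0#)

  units : ℕ
  units = count unit?

  suc-units : suc units ≡ q
  suc-units = ≡.trans (≡.cong (ℕ._+ units) (≡.sym zero-once)) (count-complement (λ a → enum a ≟ 0#))
    where
    zero-once : count (λ a → enum a ≟ 0#) ≡ 1
    zero-once = count-one (λ a → enum a ≟ 0#) (enum⁻¹ 0#) (enum-enum⁻¹ 0#) enum⁻¹-unique

  1≤units : 1 ℕ.≤ units
  1≤units = count-positive unit? (enum⁻¹ 1#) (λ 1≈0 → 1≉0 (trans (sym (enum-enum⁻¹ 1#)) 1≈0))

  []q-geometric : ∀ s → [ s ] q ℕ.* units ℕ.+ 1 ≡ q ^ s
  []q-geometric s = ≡.subst (λ b → [ s ] b ℕ.* units ℕ.+ 1 ≡ b ^ s) suc-units ([]-geometric units s)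

  units-cancel : ∀ {x y} → units ℕ.* x ≡ units ℕ.* y → x ≡ y
  units-cancel {x} {y} = ℕ.*-cancelˡ-≡ x y units {{ℕ.>-nonZero 1≤units}}

  -- The base-q digits of x ∈ Fin (q ^ s), read through enum.
  vec : ∀ s → Fin (q ^ s) → Vector s
  vec (suc s) x zero    = enum (proj₁ (remQuot {q} (q ^ s) x))
  vec (suc s) x (suc i) = vec s (proj₂ (remQuot {q} (q ^ s) x)) i

  index : ∀ s → Vector s → Fin (q ^ s)
  index zero    u = zero
  index (suc s) u = combine (enum⁻¹ (u zero)) (index s (λ i → u (suc i)))

  vec-index : ∀ s u → vec s (index s u) ≋ u
  vec-index (suc s) u zero    = trans (reflexive (≡.cong (λ p → enum (proj₁ p)) (Fin.remQuot-combine {q} {q ^ s} _ _)))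
                                      (enum-enum⁻¹ (u zero))
  vec-index (suc s) u (suc i) = trans (reflexive (≡.cong (λ p → vec s (proj₂ p) i) (Fin.remQuot-combine {q} {q ^ s} _ _)))
                                      (vec-index s (λ i → u (suc i)) i)

  vec-injective : ∀ s x y → vec s x ≋ vec s y → x ≡ y
  vec-injective zero    zero zero _ = ≡.refl
  vec-injective (suc s) x    y    x≋y = ≡.trans (≡.sym (Fin.combine-remQuot {q} (q ^ s) x))
    (≡.trans (≡.cong₂ combine (enum-inj _ _ (x≋y zero)) (vec-injective s _ _ (λ i → x≋y (suc i))))
             (Fin.combine-remQuot {q} (q ^ s) y))

  index-cong : ∀ s {u v} → u ≋ v → index s u ≡ index s v
  index-cong s {u} {v} u≋v = vec-injective s _ _ (≋-trans (vec-index s u) (≋-trans u≋v (≋-sym (vec-index s v))))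

  index-vec : ∀ s x → index s (vec s x) ≡ x
  index-vec s x = vec-injective s _ _ (vec-index s (vec s x))

  Respects≋ : ∀ {p} → (Vector s → Set p) → Set (c ⊔ ℓ ⊔ p)
  Respects≋ Q = ∀ {u v} → u ≋ v → Q u → Q v

  countV : ∀ s {p} {Q : Vector s → Set p} → (∀ u → Dec (Q u)) → ℕ
  countV s Q? = count (λ x → Q? (vec s x))

  module _ {p p′} {Q : Vector s → Set p} {Q′ : Vector s → Set p′}
           (Q? : ∀ u → Dec (Q u)) (Q′? : ∀ u → Dec (Q′ u)) (Q-resp : Respects≋ Q) (Q′-resp : Respects≋ Q′) where

    countV-bijection : (h h′ : Vector s → Vector s) →
      (∀ {u v} → u ≋ v → h u ≋ h v) → (∀ {u v} → u ≋ v → h′ u ≋ h′ v) →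
      (∀ u → h (h′ u) ≋ u) → (∀ u → h′ (h u) ≋ u) →
      (∀ u → Q u → Q′ (h u)) → (∀ u → Q′ u → Q (h′ u)) → countV s Q? ≡ countV s Q′?
    countV-bijection h h′ h-cong h′-cong hh′ h′h h-Q h′-Q′ =
      count-bijection (λ x → Q? (vec s x)) (λ x → Q′? (vec s x)) (λ x → index s (h (vec s x)))
        (λ x Qx → Q′-resp (≋-sym (vec-index s _)) (h-Q _ Qx)) φ-inj φ-onto
      where
      φ-inj : ∀ x y → Q (vec s x) → Q (vec s y) → index s (h (vec s x)) ≡ index s (h (vec s y)) → x ≡ y
      φ-inj x y _ _ eq = vec-injective s x y
        (λ i → trans (sym (h′h (vec s x) i)) (trans (h′-cong hx≋hy i) (h′h (vec s y) i)))
        where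
        hx≋hy : h (vec s x) ≋ h (vec s y)
        hx≋hy = ≋-trans (≋-sym (vec-index s _))
          (≋-trans (λ i → reflexive (≡.cong (λ z → vec s z i) eq)) (vec-index s _))
      φ-onto : ∀ y → Q′ (vec s y) → ∃ λ x → Q (vec s x) × index s (h (vec s x)) ≡ y
      φ-onto y Q′y = index s (h′ (vec s y)) , Q-resp (≋-sym (vec-index s _)) (h′-Q′ _ Q′y) ,
        ≡.trans (index-cong s (≋-trans (h-cong (vec-index s _)) (hh′ (vec s y)))) (index-vec s y)

    countV-translate : ∀ (v : Vector s) → (∀ u → Q u → Q′ (u ⊕ v)) → (∀ u → Q′ u → Q (u ⊕ (- 1#) ⊙ v)) →
      countV s Q? ≡ countV s Q′?
    countV-translate v = countV-bijection (_⊕ v) (_⊕ (- 1#) ⊙ v)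
      (λ u≋u′ i → +-congʳ (u≋u′ i)) (λ u≋u′ i → +-congʳ (u≋u′ i))
      (λ u i → trans (+-assoc _ _ _) (trans (+-congˡ (trans (+-comm _ _) (x+-1*x≈0 (v i)))) (+-identityʳ _)))
      (λ u i → trans (+-assoc _ _ _) (trans (+-congˡ (x+-1*x≈0 (v i))) (+-identityʳ _)))

  countV-≋ : ∀ s (w : Vector s) → countV s (_≋? w) ≡ 1
  countV-≋ s w = count-one (λ x → vec s x ≋? w) (index s w) (vec-index s w)
    (λ y y↦w → vec-injective s y (index s w) (≋-trans y↦w (≋-sym (vec-index s w))))

  countV-zero : ∀ s → countV s zero? ≡ 1
  countV-zero s = ≡.trans (count-cong _ (λ x → vec s x ≋? 0ᵥ) (λ _ z → z) (λ _ z → z)) (countV-≋ s 0ᵥ)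

  -- The q level sets of u ↦ y · u are translates of one another.
  module _ (y : Vector s) (y≉0 : ¬ IsZeroVector y) where

    private
      l : Fin s
      l = proj₁ (nonzero-entry y y≉0)

      yₗ≉0 : y l ≉ 0#
      yₗ≉0 = proj₂ (nonzero-entry y y≉0)

      level : Carrier → ℕ
      level t = countV s (λ u → (y · u) ≟ t)

      w : Carrier → Vector s
      w t = single l (t * inv (y l) yₗ≉0)

      y·w : ∀ t → y · w t ≈ t
      y·w t = begin
        y · w t                     ≈⟨ ·-single y l _ ⟩
        y l * (t * inv (y l) yₗ≉0)   ≈⟨ *-congˡ (*-comm t _) ⟩
        y l * (inv (y l) yₗ≉0 * t)   ≈⟨ *-assoc _ _ _ ⟨
        y l * inv (y l) yₗ≉0 * t     ≈⟨ *-congʳ (inv-inverseʳ (y l) yₗ≉0) ⟩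
        1# * t                      ≈⟨ *-identityˡ t ⟩
        t                           ∎
        where open ≈-Reasoning

      level-const : ∀ t → level t ≡ level 0#
      level-const t = ≡.sym (countV-translate (λ u → (y · u) ≟ 0#) (λ u → (y · u) ≟ t) resp resp (w t)
        (λ u y·u≈0 → trans (·-⊕ y u (w t)) (trans (+-cong y·u≈0 (y·w t)) (+-identityˡ t)))
        (λ u y·u≈t → trans (·-⊕ y u _)
          (trans (+-cong y·u≈t (trans (·-⊙ y (w t) (- 1#)) (*-congˡ (y·w t)))) (x+-1*x≈0 t))))
        where
        resp : ∀ {t} → Respects≋ (λ u → y · u ≈ t)
        resp u≋v y·u≈t = trans (sym (·-congˡ y u≋v)) y·u≈t

      level-of : ∀ x → count (λ a → (y · vec s x) ≟ enum a) ≡ 1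
      level-of x = count-one (λ a → (y · vec s x) ≟ enum a) (enum⁻¹ _) (sym (enum-enum⁻¹ _))
        (λ a y·x≈a → enum⁻¹-unique a (sym y·x≈a))

    hyperplane-size : q ℕ.* countV s (λ u → (y · u) ≟ 0#) ≡ q ^ s
    hyperplane-size = begin
      q ℕ.* level 0#                                  ≡⟨ Σℕ-const q (level 0#) ⟨
      Σℕ {q} (λ _ → level 0#)                         ≡⟨ Σℕ-cong (λ a → level-const (enum a)) ⟨
      Σℕ (λ a → level (enum a))                       ≡⟨ Σℕ-comm (λ a x → χ ((y · vec s x) ≟ enum a)) ⟩
      Σℕ (λ x → count (λ a → (y · vec s x) ≟ enum a)) ≡⟨ Σℕ-cong level-of ⟩
      Σℕ {q ^ s} (λ _ → 1)                            ≡⟨ Σℕ-const (q ^ s) 1 ⟩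
      q ^ s ℕ.* 1                                     ≡⟨ ℕ.*-identityʳ (q ^ s) ⟩
      q ^ s                                           ∎
      where open ≡-Reasoning

  2≤q : 2 ℕ.≤ q
  2≤q = ≡.subst (2 ℕ.≤_) suc-units (ℕ.s≤s 1≤units)

  -- Double counting the pairs (c, u) with c · A u = 0: for fixed c ≠ 0 the u form a hyperplane
  -- (as cᵀ A ≠ 0), and for fixed u with A u ≠ 0 the c form a hyperplane.
  module _ {m k} (A : Matrix m k) (A-ind : RowsIndependent A) where

    private
      orthogonal : Fin (q ^ m) → Fin (q ^ k) → ℕ
      orthogonal x y = χ ((vec m x · (A *ᵥ vec k y)) ≟ 0#)

      zero-c? : ∀ x → Dec (IsZeroVector (vec m x))
      zero-c? x = zero? (vec m x)

      kernel-u? : ∀ y → Dec (IsZeroVector (A *ᵥ vec k y))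
      kernel-u? y = zero? (A *ᵥ vec k y)

      count-by-c : ∀ x → ¬ IsZeroVector (vec m x) → q ℕ.* Σℕ (orthogonal x) ≡ q ^ k
      count-by-c x c≉0 = ≡.trans (≡.cong (q ℕ.*_) (count-cong _ (λ y → ((vec m x ᵥ* A) · vec k y) ≟ 0#)
          (λ y → trans (sym (·-*ᵥ (vec m x) A (vec k y)))) (λ y → trans (·-*ᵥ (vec m x) A (vec k y)))))
        (hyperplane-size (vec m x ᵥ* A) (λ cA≈0 → c≉0 (A-ind (vec m x) cA≈0)))

      count-by-u : ∀ y → ¬ IsZeroVector (A *ᵥ vec k y) → q ℕ.* Σℕ (λ x → orthogonal x y) ≡ q ^ m
      count-by-u y Au≉0 = ≡.trans (≡.cong (q ℕ.*_) (count-cong _ (λ x → ((A *ᵥ vec k y) · vec m x) ≟ 0#)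
          (λ x → trans (·-comm (A *ᵥ vec k y) (vec m x))) (λ x → trans (·-comm (vec m x) (A *ᵥ vec k y)))))
        (hyperplane-size (A *ᵥ vec k y) Au≉0)

      pairs-by-c : q ℕ.* Σℕ (λ x → Σℕ (orthogonal x)) ≡ 1 ℕ.* (q ℕ.* q ^ k) ℕ.+ count (λ x → ¬? (zero-c? x)) ℕ.* q ^ k
      pairs-by-c = ≡.trans (*-distribˡ-Σℕ q (λ x → Σℕ (orthogonal x)))
        (≡.trans (Σℕ-two-valued zero-c? (λ x → q ℕ.* Σℕ (orthogonal x)) (q ℕ.* q ^ k) (q ^ k)
                    (λ x c≈0 → ≡.cong (q ℕ.*_) (count-all _ (λ y → ·-zeroˡ (vec m x) c≈0))) count-by-c)
                 (≡.cong (λ n → n ℕ.* (q ℕ.* q ^ k) ℕ.+ count (λ x → ¬? (zero-c? x)) ℕ.* q ^ k) (countV-zero m)))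

      pairs-by-u : q ℕ.* Σℕ (λ x → Σℕ (orthogonal x)) ≡
                   countV k (λ u → zero? (A *ᵥ u)) ℕ.* (q ℕ.* q ^ m) ℕ.+ count (λ y → ¬? (kernel-u? y)) ℕ.* q ^ m
      pairs-by-u = ≡.trans (≡.cong (q ℕ.*_) (Σℕ-comm orthogonal))
        (≡.trans (*-distribˡ-Σℕ q (λ y → Σℕ (λ x → orthogonal x y)))
                 (Σℕ-two-valued kernel-u? (λ y → q ℕ.* Σℕ (λ x → orthogonal x y)) (q ℕ.* q ^ m) (q ^ m)
                    (λ y Au≈0 → ≡.cong (q ℕ.*_) (count-all _ (λ x → ·-zeroʳ (vec m x) Au≈0))) count-by-u))

    kernel-size : m ℕ.≤ k → countV k (λ u → zero? (A *ᵥ u)) ≡ q ^ (k ℕ.∸ m)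
    kernel-size m≤k = ≡.subst (λ b → b ^ k ≡ Z ℕ.* b ^ m → Z ≡ b ^ (k ℕ.∸ m)) suc-units
      (^-quotient units m k Z m≤k) q^k≡Z*q^m
      where
      Z W N : ℕ
      Z = countV k (λ u → zero? (A *ᵥ u))
      W = count (λ y → ¬? (kernel-u? y))
      N = count (λ x → ¬? (zero-c? x))
      q^k≡Z+W : q ^ k ≡ Z ℕ.+ W
      q^k≡Z+W = ≡.sym (count-complement kernel-u?)
      q^m≡1+N : q ^ m ≡ suc N
      q^m≡1+N = ≡.trans (≡.sym (count-complement zero-c?)) (≡.cong (ℕ._+ N) (countV-zero m))
      q^k≡Z*q^m : q ^ k ≡ Z ℕ.* q ^ m
      q^k≡Z*q^m = ≡.trans q^k≡Z+W (≡.trans (double-count-cancel q N Z W 2≤q (begin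
        q ℕ.* (Z ℕ.+ W) ℕ.+ N ℕ.* (Z ℕ.+ W)           ≡⟨ ≡.cong (λ t → q ℕ.* t ℕ.+ N ℕ.* t) q^k≡Z+W ⟨
        q ℕ.* q ^ k ℕ.+ N ℕ.* q ^ k                   ≡⟨ ≡.cong (ℕ._+ N ℕ.* q ^ k) (ℕ.*-identityˡ (q ℕ.* q ^ k)) ⟨
        1 ℕ.* (q ℕ.* q ^ k) ℕ.+ N ℕ.* q ^ k           ≡⟨ pairs-by-c ⟨
        q ℕ.* Σℕ (λ x → Σℕ (orthogonal x))           ≡⟨ pairs-by-u ⟩
        Z ℕ.* (q ℕ.* q ^ m) ℕ.+ W ℕ.* q ^ m           ≡⟨ ≡.cong (λ t → Z ℕ.* (q ℕ.* t) ℕ.+ W ℕ.* t) q^m≡1+N ⟩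
        Z ℕ.* (q ℕ.* suc N) ℕ.+ W ℕ.* suc N           ∎))
        (≡.cong (Z ℕ.*_) (≡.sym q^m≡1+N)))
        where open ≡-Reasoning

  ∝-⊙ : ∀ {a} (u : Vector r) → a ≉ 0# → a ⊙ u ∝ u
  ∝-⊙ {a = a} u a≉0 = a , a≉0 , λ i → refl

  ≋⇒∝ : ∀ {u v : Vector r} → u ≋ v → u ∝ v
  ≋⇒∝ u≋v = 1# , 1≉0 , λ i → trans (u≋v i) (sym (*-identityˡ _))

  remQuot-injective : ∀ {n} (x y : Fin (q ℕ.* n)) → remQuot {q} n x ≡ remQuot {q} n y → x ≡ y
  remQuot-injective {n} x y eq = ≡.trans (≡.sym (Fin.combine-remQuot {q} n x))
    (≡.trans (≡.cong (λ (a , j) → combine a j) eq) (Fin.combine-remQuot {q} n y))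

  -- The non-zero multiples a·gⱼ of the columns of a simplex generator matrix are pairwise distinct,
  -- and there are (q - 1)·[k]_q = q^k - 1 of them: they are exactly the non-zero vectors of F^k.
  module SimplexColumns {k} (G : Matrix k ([ k ] q))
    (G-nonzero : ∀ j → ¬ IsZeroVector (column G j))
    (G-distinct : ∀ j j′ → j ≢ j′ → ¬ column G j ∝ column G j′) where

    private
      n : ℕ
      n = [ k ] q

      g : Fin n → Vector k
      g = column G

      -- x ∈ Fin (q · n) encodes a pair (a, j); multiple x is the index of a · gⱼ in F^k.
      scalar : Fin (q ℕ.* n) → Carrier
      scalar x = enum (proj₁ (remQuot {q} n x))

      col : Fin (q ℕ.* n) → Fin n
      col x = proj₂ (remQuot {q} n x)

      NonzeroScalar : Fin (q ℕ.* n) → Set ℓ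
      NonzeroScalar x = scalar x ≉ 0#

      nonzero-scalar? : ∀ x → Dec (NonzeroScalar x)
      nonzero-scalar? x = ¬? (scalar x ≟ 0#)

      multiple : Fin (q ℕ.* n) → Fin (q ^ k)
      multiple x = index k (scalar x ⊙ g (col x))

      vec-multiple : ∀ x → vec k (multiple x) ≋ scalar x ⊙ g (col x)
      vec-multiple x = vec-index k _

      multiple-nonzero : ∀ x → NonzeroScalar x → ¬ IsZeroVector (vec k (multiple x))
      multiple-nonzero x aₓ≉0 ax≈0 =
        G-nonzero (col x) (∝-zero (∝-⊙ (g (col x)) aₓ≉0) (λ i → trans (sym (vec-multiple x i)) (ax≈0 i)))

      multiple-≋ : ∀ {x y} → multiple x ≡ multiple y → scalar x ⊙ g (col x) ≋ scalar y ⊙ g (col y)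
      multiple-≋ {x} {y} eq =
        ≋-trans (≋-sym (vec-multiple x)) (≋-trans (λ i → reflexive (≡.cong (λ z → vec k z i) eq)) (vec-multiple y))

      multiple-injective : ∀ x y → NonzeroScalar x → NonzeroScalar y → multiple x ≡ multiple y → x ≡ y
      multiple-injective x y aₓ≉0 a_y≉0 eq with col x Fin.≟ col y | nonzero-entry (g (col x)) (G-nonzero (col x))
      ... | no  jₓ≢j_y | _ = ⊥-elim (G-distinct _ _ jₓ≢j_y
            (∝-trans (∝-sym (∝-⊙ (g (col x)) aₓ≉0)) (∝-trans (≋⇒∝ (multiple-≋ eq)) (∝-⊙ (g (col y)) a_y≉0))))
      ... | yes jₓ≡j_y | i , gᵢ≉0 = remQuot-injective x y (≡.cong₂ _,_ (enum-inj _ _ aₓ≈a_y) jₓ≡j_y)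
        where
        aₓ≈a_y : scalar x ≈ scalar y
        aₓ≈a_y = *-cancelʳ-nonzero (g (col x) i) gᵢ≉0
          (trans (multiple-≋ eq i) (*-congˡ (reflexive (≡.cong (λ j → g j i) (≡.sym jₓ≡j_y)))))

      count-units : count nonzero-scalar? ≡ n ℕ.* units
      count-units = ≡.trans (Σℕ-remQuot q (λ a j → χ (unit? a)))
        (≡.trans (Σℕ-cong (λ a → Σℕ-const n (χ (unit? a)))) (≡.sym (*-distribˡ-Σℕ n (λ a → χ (unit? a)))))

      count-units≡count-nonzero : count nonzero-scalar? ≡ countV k (λ u → ¬? (zero? u))
      count-units≡count-nonzero = ℕ.+-cancelˡ-≡ 1 _ _ (begin
        1 ℕ.+ count nonzero-scalar?                    ≡⟨ ≡.cong suc count-units ⟩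
        1 ℕ.+ n ℕ.* units                    ≡⟨ ℕ.+-comm 1 _ ⟩
        n ℕ.* units ℕ.+ 1                    ≡⟨ []q-geometric k ⟩
        q ^ k                                ≡⟨ count-complement (λ y → zero? (vec k y)) ⟨
        countV k zero? ℕ.+ countV k (λ u → ¬? (zero? u)) ≡⟨ ≡.cong (ℕ._+ countV k (λ u → ¬? (zero? u))) (countV-zero k) ⟩
        1 ℕ.+ countV k (λ u → ¬? (zero? u))  ∎)
        where open ≡-Reasoning

    covers : ∀ u → ¬ IsZeroVector u → ∃ λ j → ∃ λ b → b ≉ 0# × u ≋ b ⊙ g j
    covers u u≉0 = col x , scalar x , aₓ≉0 , λ i → trans (sym (vec-index k u i))
        (trans (reflexive (≡.cong (λ z → vec k z i) (≡.sym multiple≡u))) (vec-multiple x i))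
      where
      hit : ∃ λ x → NonzeroScalar x × multiple x ≡ index k u
      hit = equal-count⇒onto nonzero-scalar? (λ y → ¬? (zero? (vec k y))) multiple multiple-nonzero multiple-injective
              count-units≡count-nonzero (index k u) (λ u′≈0 → u≉0 (λ i → trans (sym (vec-index k u i)) (u′≈0 i)))
      x : Fin (q ℕ.* n)
      x = proj₁ hit
      aₓ≉0 : NonzeroScalar x
      aₓ≉0 = proj₁ (proj₂ hit)
      multiple≡u : multiple x ≡ index k u
      multiple≡u = proj₂ (proj₂ hit)

    module _ {p} {Q : Vector k → Set p} (Q? : ∀ u → Dec (Q u)) (Q-resp : Respects≋ Q)
             (Q-scale : ∀ {a u} → a ≉ 0# → Q u → Q (a ⊙ u)) (Q-nonzero : ∀ u → Q u → ¬ IsZeroVector u) where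

      private
        ScaledQ? : ∀ x → Dec (NonzeroScalar x × Q (g (col x)))
        ScaledQ? x = nonzero-scalar? x ×-dec Q? (g (col x))

        count-ScaledQ : count ScaledQ? ≡ units ℕ.* count (λ j → Q? (g j))
        count-ScaledQ = begin
          count ScaledQ?                                   ≡⟨ Σℕ-remQuot q (λ a j → χ (unit? a ×-dec Q? (g j))) ⟩
          Σℕ (λ a → count (λ j → unit? a ×-dec Q? (g j)))  ≡⟨ Σℕ-cong (λ a → count-×ˡ (unit? a) (λ j → Q? (g j))) ⟩
          Σℕ (λ a → χ (unit? a) ℕ.* count (λ j → Q? (g j))) ≡⟨ Σℕ-*ʳ (count (λ j → Q? (g j))) (λ a → χ (unit? a)) ⟩
          units ℕ.* count (λ j → Q? (g j))                 ∎
          where open ≡-Reasoning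

        multiple-onto : ∀ y → Q (vec k y) → ∃ λ x → (NonzeroScalar x × Q (g (col x))) × multiple x ≡ y
        multiple-onto y Qy = combine (enum⁻¹ b) j ,
          ≡.subst (λ (a , j) → enum a ≉ 0# × Q (g j)) (≡.sym (Fin.remQuot-combine _ _)) (a≉0 , Qgⱼ) ,
          ≡.trans (≡.cong (λ (a , j) → index k (enum a ⊙ g j)) (Fin.remQuot-combine (enum⁻¹ b) j))
            (≡.trans (index-cong k (λ i → trans (*-congʳ (enum-enum⁻¹ b)) (sym (y≋bgⱼ i)))) (index-vec k y))
          where
          cover : ∃ λ j → ∃ λ b → b ≉ 0# × vec k y ≋ b ⊙ g j
          cover = covers (vec k y) (Q-nonzero _ Qy)
          j : Fin n
          j = proj₁ cover
          b : Carrier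
          b = proj₁ (proj₂ cover)
          b≉0 : b ≉ 0#
          b≉0 = proj₁ (proj₂ (proj₂ cover))
          y≋bgⱼ : vec k y ≋ b ⊙ g j
          y≋bgⱼ = proj₂ (proj₂ (proj₂ cover))
          a≉0 : enum (enum⁻¹ b) ≉ 0#
          a≉0 a≈0 = b≉0 (trans (sym (enum-enum⁻¹ b)) a≈0)
          Qgⱼ : Q (g j)
          Qgⱼ = Q-resp (λ i → inv-cancelˡ b b≉0 (g j i)) (Q-scale (inv-nonzero b b≉0) (Q-resp y≋bgⱼ Qy))

      count-columns : units ℕ.* count (λ j → Q? (g j)) ≡ countV k Q?
      count-columns = ≡.trans (≡.sym count-ScaledQ)
        (count-bijection ScaledQ? (λ y → Q? (vec k y)) multiple
          (λ x (aₓ≉0 , Qgⱼ) → Q-resp (≋-sym (vec-multiple x)) (Q-scale aₓ≉0 Qgⱼ))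
          (λ x y (aₓ≉0 , _) (a_y≉0 , _) → multiple-injective x y aₓ≉0 a_y≉0) multiple-onto)

  module _ {k m} (m≤k : m ℕ.≤ k) (G : Matrix k ([ k ] q))
    (G-nonzero : ∀ j → ¬ IsZeroVector (column G j))
    (G-distinct : ∀ j j′ → j ≢ j′ → ¬ column G j ∝ column G j′)
    (M : Matrix m ([ k ] q)) (M-ind : RowsIndependent M) (M⊆G : ∀ i → InRowSpace G (M i)) where

    open SimplexColumns G G-nonzero G-distinct

    private
      g : Fin ([ k ] q) → Vector k
      g = column G

      A : Matrix m k
      A i = proj₁ (M⊆G i)

      column-M : ∀ j → column M j ≋ A *ᵥ g j
      column-M j i = proj₂ (M⊆G i) j

      A-ind : RowsIndependent A
      A-ind c cA≈0 = M-ind c (λ j → begin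
        (c ᵥ* M) j          ≈⟨ ∑-cong (λ i → *-congˡ (column-M j i)) ⟩
        c · (A *ᵥ g j)      ≈⟨ ·-*ᵥ c A (g j) ⟩
        (c ᵥ* A) · g j      ≈⟨ ·-zeroˡ (c ᵥ* A) cA≈0 ⟩
        0#                  ∎)
        where open ≈-Reasoning

      kernel : ℕ
      kernel = countV k (λ u → zero? (A *ᵥ u))

      InKernel* : Vector k → Set ℓ
      InKernel* u = ¬ IsZeroVector u × IsZeroVector (A *ᵥ u)

      inKernel*? : ∀ u → Dec (InKernel* u)
      inKernel*? u = ¬? (zero? u) ×-dec zero? (A *ᵥ u)

      kernel≡1+kernel* : kernel ≡ countV k inKernel*? ℕ.+ 1
      kernel≡1+kernel* = ≡.trans (count-split (λ y → zero? (A *ᵥ vec k y)) (λ y → ¬? (zero? (vec k y))))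
        (≡.cong₂ ℕ._+_
          (count-cong _ (λ y → inKernel*? (vec k y)) (λ _ (Au≈0 , u≉0) → u≉0 , Au≈0) (λ _ (u≉0 , Au≈0) → Au≈0 , u≉0))
          (≡.trans (count-cong _ (λ y → zero? (vec k y))
                     (λ y (_ , ¬u≉0) → Dec.decidable-stable (zero? (vec k y)) ¬u≉0)
                     (λ y u≈0 → *ᵥ-zero A u≈0 , λ u≉0 → u≉0 u≈0))
                   (countV-zero k)))

      count-kernel*-columns : units ℕ.* count (λ j → inKernel*? (g j)) ≡ countV k inKernel*?
      count-kernel*-columns = count-columns inKernel*?
        (λ u≋v (u≉0 , Au≈0) → (λ v≈0 → u≉0 (λ i → trans (u≋v i) (v≈0 i))) ,
                              λ i → trans (sym (*ᵥ-congˡ A u≋v i)) (Au≈0 i))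
        (λ {a} {u} a≉0 (u≉0 , Au≈0) → (λ au≈0 → u≉0 (∝-zero (∝-⊙ u a≉0) au≈0)) ,
                                       λ i → trans (*ᵥ-⊙ A u a i) (trans (*-congˡ (Au≈0 i)) (zeroʳ a)))
        (λ _ → proj₁)

    count-zero-columns : count (λ j → zero? (column M j)) ≡ [ k ℕ.∸ m ] q
    count-zero-columns = units-cancel (ℕ.+-cancelʳ-≡ 1 _ _ (begin
      units ℕ.* count (λ j → zero? (column M j)) ℕ.+ 1     ≡⟨ ≡.cong (λ t → units ℕ.* t ℕ.+ 1) zero⇔kernel* ⟩
      units ℕ.* count (λ j → inKernel*? (g j)) ℕ.+ 1       ≡⟨ ≡.cong (ℕ._+ 1) count-kernel*-columns ⟩
      countV k inKernel*? ℕ.+ 1                            ≡⟨ kernel≡1+kernel* ⟨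
      kernel                                               ≡⟨ kernel-size A A-ind m≤k ⟩
      q ^ (k ℕ.∸ m)                                        ≡⟨ []q-geometric (k ℕ.∸ m) ⟨
      [ k ℕ.∸ m ] q ℕ.* units ℕ.+ 1                        ≡⟨ ≡.cong (ℕ._+ 1) (ℕ.*-comm ([ k ℕ.∸ m ] q) units) ⟩
      units ℕ.* [ k ℕ.∸ m ] q ℕ.+ 1                        ∎))
      where
      open ≡-Reasoning
      zero⇔kernel* : count (λ j → zero? (column M j)) ≡ count (λ j → inKernel*? (g j))
      zero⇔kernel* = count-cong _ _ (λ j Mⱼ≈0 → G-nonzero j , λ i → trans (sym (column-M j i)) (Mⱼ≈0 i))
                                    (λ j (_ , Agⱼ≈0) i → trans (column-M j i) (Agⱼ≈0 i))

    module _ (j₀ : Fin ([ k ] q)) (v≉0 : ¬ IsZeroVector (column M j₀)) where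

      private
        v : Vector m
        v = column M j₀

        coset-size : ∀ t → countV k (λ u → (A *ᵥ u) ≋? (t ⊙ v)) ≡ kernel
        coset-size t = ≡.sym (countV-translate (λ u → zero? (A *ᵥ u)) (λ u → (A *ᵥ u) ≋? (t ⊙ v))
          (λ u≋u′ Au≈0 i → trans (sym (*ᵥ-congˡ A u≋u′ i)) (Au≈0 i))
          (λ u≋u′ Au≋tv i → trans (sym (*ᵥ-congˡ A u≋u′ i)) (Au≋tv i))
          (t ⊙ g j₀)
          (λ u Au≈0 i → begin
            (A *ᵥ (u ⊕ t ⊙ g j₀)) i     ≈⟨ *ᵥ-⊕ A u _ i ⟩
            (A *ᵥ u) i + (A *ᵥ (t ⊙ g j₀)) i ≈⟨ +-cong (Au≈0 i) (*ᵥ-⊙ A (g j₀) t i) ⟩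
            0# + t * (A *ᵥ g j₀) i       ≈⟨ +-identityˡ _ ⟩
            t * (A *ᵥ g j₀) i            ≈⟨ *-congˡ (column-M j₀ i) ⟨
            t * v i                      ∎)
          (λ u Au≋tv i → begin
            (A *ᵥ (u ⊕ (- 1#) ⊙ (t ⊙ g j₀))) i       ≈⟨ *ᵥ-⊕ A u _ i ⟩
            (A *ᵥ u) i + (A *ᵥ ((- 1#) ⊙ (t ⊙ g j₀))) i ≈⟨ +-congˡ (trans (*ᵥ-⊙ A _ (- 1#) i) (*-congˡ (*ᵥ-⊙ A (g j₀) t i))) ⟩
            (A *ᵥ u) i + - 1# * (t * (A *ᵥ g j₀) i)  ≈⟨ +-cong (Au≋tv i) (*-congˡ (*-congˡ (sym (column-M j₀ i)))) ⟩
            t * v i + - 1# * (t * v i)               ≈⟨ x+-1*x≈0 (t * v i) ⟩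
            0#                                       ∎))
          where open ≈-Reasoning

        coset? : ∀ a y → Dec (A *ᵥ vec k y ≋ enum a ⊙ v)
        coset? a y = (A *ᵥ vec k y) ≋? (enum a ⊙ v)

        match? : ∀ a y → Dec (enum a ≉ 0# × A *ᵥ vec k y ≋ enum a ⊙ v)
        match? a y = unit? a ×-dec coset? a y

        unique-scalar : ∀ y → count (λ a → match? a y) ≡ χ ((A *ᵥ vec k y) ∝? v)
        unique-scalar y with (A *ᵥ vec k y) ∝? v | nonzero-entry v v≉0
        ... | yes (b , b≉0 , Au≋bv) | i , vᵢ≉0 = count-one (λ a → match? a y) (enum⁻¹ b)
                ((λ a≈0 → b≉0 (trans (sym (enum-enum⁻¹ b)) a≈0)) , λ i → trans (Au≋bv i) (*-congʳ (sym (enum-enum⁻¹ b))))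
                (λ a (_ , Au≋av) → enum⁻¹-unique a (*-cancelʳ-nonzero (v i) vᵢ≉0 (trans (sym (Au≋av i)) (Au≋bv i))))
        ... | no ¬Au∝v | _ = count-none (λ a → match? a y) (λ a (a≉0 , Au≋av) → ¬Au∝v (enum a , a≉0 , Au≋av))

        count-∝ : countV k (λ u → (A *ᵥ u) ∝? v) ≡ units ℕ.* kernel
        count-∝ = begin
          countV k (λ u → (A *ᵥ u) ∝? v)                  ≡⟨ Σℕ-cong unique-scalar ⟨
          Σℕ (λ y → count (λ a → match? a y))             ≡⟨ Σℕ-comm (λ y a → χ (match? a y)) ⟩
          Σℕ (λ a → count (λ y → match? a y))             ≡⟨ Σℕ-cong (λ a → count-×ˡ (unit? a) (coset? a)) ⟩
          Σℕ (λ a → χ (unit? a) ℕ.* count (coset? a))     ≡⟨ Σℕ-cong (λ a → ≡.cong (χ (unit? a) ℕ.*_) (coset-size (enum a))) ⟩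
          Σℕ (λ a → χ (unit? a) ℕ.* kernel)               ≡⟨ Σℕ-*ʳ kernel (λ a → χ (unit? a)) ⟩
          units ℕ.* kernel                                ∎
          where open ≡-Reasoning

        count-∝-columns : units ℕ.* count (λ j → (A *ᵥ g j) ∝? v) ≡ countV k (λ u → (A *ᵥ u) ∝? v)
        count-∝-columns = count-columns (λ u → (A *ᵥ u) ∝? v)
          (λ u≋u′ → ∝-trans (≋⇒∝ (≋-sym (*ᵥ-congˡ A u≋u′))))
          (λ {a} {u} a≉0 Au∝v → ∝-trans (≋⇒∝ (*ᵥ-⊙ A u a)) (∝-trans (∝-⊙ (A *ᵥ u) a≉0) Au∝v))
          (λ u Au∝v u≈0 → v≉0 (∝-zero Au∝v (*ᵥ-zero A u≈0)))

      count-proportional-columns : count (λ j → column M j ∝? v) ≡ q ^ (k ℕ.∸ m)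
      count-proportional-columns = units-cancel (begin
        units ℕ.* count (λ j → column M j ∝? v)       ≡⟨ ≡.cong (units ℕ.*_) (count-cong _ (λ j → (A *ᵥ g j) ∝? v)
                                                           (λ j → ∝-trans (≋⇒∝ (≋-sym (column-M j))))
                                                           (λ j → ∝-trans (≋⇒∝ (column-M j)))) ⟩
        units ℕ.* count (λ j → (A *ᵥ g j) ∝? v)       ≡⟨ count-∝-columns ⟩
        countV k (λ u → (A *ᵥ u) ∝? v)                ≡⟨ count-∝ ⟩
        units ℕ.* kernel                              ≡⟨ ≡.cong (units ℕ.*_) (kernel-size A A-ind m≤k) ⟩
        units ℕ.* q ^ (k ℕ.∸ m)                       ∎)
        where open ≡-Reasoning

    star-of-simplex-rows : Star q k M
    star-of-simplex-rows =
      ≡.subst (HasExactly _) count-zero-columns (count-hasExactly (λ j → zero? (column M j))) ,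
      λ j₀ v≉0 → ≡.subst (HasExactly _) (count-proportional-columns j₀ v≉0)
                                         (count-hasExactly (λ j → column M j ∝? column M j₀))

  -- Representatives of the points of projective (s-1)-space: their first non-zero coordinate is 1,
  -- matching [s + 1]_q = q^s + [s]_q.
  mutual
    point : ∀ s → Fin ([ s ] q) → Vector s
    point (suc s) x = point′ s (Fin.splitAt (q ^ s) x)

    point′ : ∀ s → Fin (q ^ s) ⊎ Fin ([ s ] q) → Vector (suc s)
    point′ s (inj₁ x) = 1# ∷ vec s x
    point′ s (inj₂ x) = 0# ∷ point s x

  mutual
    point-nonzero : ∀ s x → ¬ IsZeroVector (point s x)
    point-nonzero (suc s) x = point′-nonzero s (Fin.splitAt (q ^ s) x)

    point′-nonzero : ∀ s x → ¬ IsZeroVector (point′ s x)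
    point′-nonzero s (inj₁ x) p≈0 = 1≉0 (p≈0 zero)
    point′-nonzero s (inj₂ x) p≈0 = point-nonzero s x (λ i → p≈0 (suc i))

  mutual
    point-∝⇒≡ : ∀ s x y → point s x ∝ point s y → x ≡ y
    point-∝⇒≡ (suc s) x y p∝p′ = ≡.trans (≡.sym (Fin.join-splitAt (q ^ s) ([ s ] q) x))
      (≡.trans (≡.cong (Fin.join (q ^ s) ([ s ] q)) (point′-∝⇒≡ s (Fin.splitAt (q ^ s) x) (Fin.splitAt (q ^ s) y) p∝p′))
               (Fin.join-splitAt (q ^ s) ([ s ] q) y))

    point′-∝⇒≡ : ∀ s x y → point′ s x ∝ point′ s y → x ≡ y
    point′-∝⇒≡ s (inj₁ x) (inj₁ y) (t , _ , p≈tp′) = ≡.cong inj₁ (vec-injective s x y (λ i →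
      trans (p≈tp′ (suc i)) (trans (*-congʳ t≈1) (*-identityˡ _))))
      where
      t≈1 : t ≈ 1#
      t≈1 = sym (trans (p≈tp′ zero) (*-identityʳ t))
    point′-∝⇒≡ s (inj₁ x) (inj₂ y) (t , _ , p≈tp′)   = ⊥-elim (1≉0 (trans (p≈tp′ zero) (zeroʳ t)))
    point′-∝⇒≡ s (inj₂ x) (inj₁ y) (t , t≉0 , p≈tp′) = ⊥-elim (t≉0 (sym (trans (p≈tp′ zero) (*-identityʳ t))))
    point′-∝⇒≡ s (inj₂ x) (inj₂ y) (t , t≉0 , p≈tp′) = ≡.cong inj₂ (point-∝⇒≡ s x y (t , t≉0 , λ i → p≈tp′ (suc i)))

  module _ {m d} (M : Matrix m ([ m ℕ.+ d ] q)) (M-ind : RowsIndependent M)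
    (zero-columns : HasExactly (λ j → IsZeroVector (column M j)) ([ d ] q))
    (classes : ∀ j → ¬ IsZeroVector (column M j) → HasExactly (λ j′ → column M j′ ∝ column M j) (q ^ d)) where

    private
      n : ℕ
      n = [ m ℕ.+ d ] q

      col : Fin n → Vector m
      col = column M

      zero-index : ∀ j → IsZeroVector (col j) → Fin ([ d ] q)
      zero-index j j≈0 = proj₁ (proj₂ (proj₂ (proj₂ zero-columns)) j j≈0)

      zero-index-injective : ∀ j j′ j≈0 j′≈0 → zero-index j j≈0 ≡ zero-index j′ j′≈0 → j ≡ j′
      zero-index-injective j j′ j≈0 j′≈0 eq = ≡.trans (≡.sym (proj₂ (proj₂ (proj₂ (proj₂ zero-columns)) j j≈0)))
        (≡.trans (≡.cong (proj₁ zero-columns) eq) (proj₂ (proj₂ (proj₂ (proj₂ zero-columns)) j′ j′≈0)))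

      -- Canonical, so that all members of a class agree on the enumeration of the class they use.
      rep : Fin n → Fin n
      rep j = least (λ j′ → col j′ ∝? col j) j

      rep-∝ : ∀ j → col (rep j) ∝ col j
      rep-∝ j = least-P (λ j′ → col j′ ∝? col j) j (∝-refl (col j))

      rep-cong : ∀ {j j′} → col j ∝ col j′ → rep j ≡ rep j′
      rep-cong j∝j′ = least-cong _ _ (λ _ i∝j → ∝-trans i∝j j∝j′) (λ _ i∝j′ → ∝-trans i∝j′ (∝-sym j∝j′)) _ _ (∝-refl _)

      rep-nonzero : ∀ j → ¬ IsZeroVector (col j) → ¬ IsZeroVector (col (rep j))
      rep-nonzero j j≉0 = ∝-nonzero (∝-sym (rep-∝ j)) j≉0

      -- The enumeration of the class of r provided by `classes` (junk when column r is zero).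
      enumeration : Fin n → Fin (q ^ d) → Fin n
      enumeration r with zero? (col r)
      ... | yes _   = λ _ → r
      ... | no  r≉0 = proj₁ (classes r r≉0)

      module _ (r : Fin n) (r≉0 : ¬ IsZeroVector (col r)) where

        enumeration-∝ : ∀ x → col (enumeration r x) ∝ col r
        enumeration-∝ with zero? (col r)
        ... | yes r≈0 = ⊥-elim (r≉0 r≈0)
        ... | no r≉0′ = proj₁ (proj₂ (classes r r≉0′))

        enumeration-injective : ∀ x y → enumeration r x ≡ enumeration r y → x ≡ y
        enumeration-injective with zero? (col r)
        ... | yes r≈0 = ⊥-elim (r≉0 r≈0)
        ... | no r≉0′ = proj₁ (proj₂ (proj₂ (classes r r≉0′)))

        enumeration-onto : ∀ j → col j ∝ col r → ∃ λ x → enumeration r x ≡ j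
        enumeration-onto with zero? (col r)
        ... | yes r≈0 = ⊥-elim (r≉0 r≈0)
        ... | no r≉0′ = proj₂ (proj₂ (proj₂ (classes r r≉0′)))

      member : Fin n → Fin (q ^ d) → Fin n
      member j = enumeration (rep j)

      module _ (j : Fin n) (j≉0 : ¬ IsZeroVector (col j)) where

        member-∝ : ∀ x → col (member j x) ∝ col j
        member-∝ x = ∝-trans (enumeration-∝ (rep j) (rep-nonzero j j≉0) x) (rep-∝ j)

        member-injective : ∀ x y → member j x ≡ member j y → x ≡ y
        member-injective = enumeration-injective (rep j) (rep-nonzero j j≉0)

        position : Fin (q ^ d)
        position = proj₁ (enumeration-onto (rep j) (rep-nonzero j j≉0) j (∝-sym (rep-∝ j)))

        member-position : member j position ≡ j
        member-position = proj₂ (enumeration-onto (rep j) (rep-nonzero j j≉0) j (∝-sym (rep-∝ j)))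

        scale : Carrier
        scale = proj₁ (∝-sym (rep-∝ j))

        scale-nonzero : scale ≉ 0#
        scale-nonzero = proj₁ (proj₂ (∝-sym (rep-∝ j)))

        col≋scale⊙rep : col j ≋ scale ⊙ col (rep j)
        col≋scale⊙rep = proj₂ (proj₂ (∝-sym (rep-∝ j)))

      position-member : ∀ j j≉0 x j′≉0 → position (member j x) j′≉0 ≡ x
      position-member j j≉0 x j′≉0 = member-injective j j≉0 _ _
        (≡.trans (≡.cong (λ r → enumeration r (position (member j x) j′≉0)) (≡.sym (rep-cong (member-∝ j j≉0 x))))
                 (member-position (member j x) j′≉0))

      bottom′ : ∀ j → Dec (IsZeroVector (col j)) → Vector d
      bottom′ j (yes j≈0) = point d (zero-index j j≈0)
      bottom′ j (no j≉0)  = scale j j≉0 ⊙ vec d (position j j≉0)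

      bottom : Fin n → Vector d
      bottom j = bottom′ j (zero? (col j))

    -- Zero columns are extended by the distinct projective points, and the q^d columns of a class
    -- c·v (v the representative) by c times the q^d distinct vectors of F^d.
    extension : Matrix (m ℕ.+ d) n
    extension i j = (col j ++ bottom j) i

    private
      top≋ : ∀ j → (λ i → extension (i Fin.↑ˡ d) j) ≋ col j
      top≋ j i = reflexive (lookup-++ˡ (col j) (bottom j) i)

      bottom≋ : ∀ j → (λ l → extension (m Fin.↑ʳ l) j) ≋ bottom j
      bottom≋ j l = reflexive (lookup-++ʳ (col j) (bottom j) l)

      split-∝ : ∀ {j j′} → column extension j ∝ column extension j′ →
        ∃ λ t → t ≉ 0# × col j ≋ t ⊙ col j′ × bottom j ≋ t ⊙ bottom j′
      split-∝ {j} {j′} (t , t≉0 , Gⱼ≋tGⱼ′) = t , t≉0 ,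
        (λ i → trans (sym (top≋ j i)) (trans (Gⱼ≋tGⱼ′ (i Fin.↑ˡ d)) (*-congˡ (top≋ j′ i)))) ,
        (λ l → trans (sym (bottom≋ j l)) (trans (Gⱼ≋tGⱼ′ (m Fin.↑ʳ l)) (*-congˡ (bottom≋ j′ l))))

      ᵥ*-extension : ∀ (c : Vector (m ℕ.+ d)) j →
        (c ᵥ* extension) j ≈ (λ i → c (i Fin.↑ˡ d)) · col j + (λ l → c (m Fin.↑ʳ l)) · bottom j
      ᵥ*-extension c j = trans (∑-++ m (λ i → c i * extension i j))
        (+-cong (∑-cong (λ i → *-congˡ (top≋ j i))) (∑-cong (λ l → *-congˡ (bottom≋ j l))))

      -- Proportional columns share their representative r, so the scales agree up to t and
      -- then the positions in the enumeration of the class of r agree.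
      same-class⇒≡ : ∀ j j′ (j≉0 : ¬ IsZeroVector (col j)) (j′≉0 : ¬ IsZeroVector (col j′)) t → t ≉ 0# →
        col j ≋ t ⊙ col j′ → bottom′ j (no j≉0) ≋ t ⊙ bottom′ j′ (no j′≉0) → j ≡ j′
      same-class⇒≡ j j′ j≉0 j′≉0 t t≉0 top bot = ≡.trans (≡.sym (member-position j j≉0))
        (≡.trans (≡.cong₂ enumeration r≡r′ pos≡pos′) (member-position j′ j′≉0))
        where
        open ≈-Reasoning
        r≡r′ : rep j ≡ rep j′
        r≡r′ = rep-cong (t , t≉0 , top)
        a a′ : Carrier
        a = scale j j≉0
        a′ = scale j′ j′≉0
        i₀ : Fin m
        i₀ = proj₁ (nonzero-entry (col (rep j)) (rep-nonzero j j≉0))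
        a≈ta′ : a ≈ t * a′
        a≈ta′ = *-cancelʳ-nonzero (col (rep j) i₀) (proj₂ (nonzero-entry (col (rep j)) (rep-nonzero j j≉0))) (begin
          a * col (rep j) i₀              ≈⟨ col≋scale⊙rep j j≉0 i₀ ⟨
          col j i₀                        ≈⟨ top i₀ ⟩
          t * col j′ i₀                   ≈⟨ *-congˡ (col≋scale⊙rep j′ j′≉0 i₀) ⟩
          t * (a′ * col (rep j′) i₀)      ≈⟨ *-congˡ (*-congˡ (reflexive (≡.cong (λ r → col r i₀) (≡.sym r≡r′)))) ⟩
          t * (a′ * col (rep j) i₀)       ≈⟨ *-assoc _ _ _ ⟨
          t * a′ * col (rep j) i₀         ∎)
        pos≡pos′ : position j j≉0 ≡ position j′ j′≉0
        pos≡pos′ = vec-injective d _ _ (λ l → *-cancelˡ-nonzero a (scale-nonzero j j≉0) (begin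
          a * vec d (position j j≉0) l          ≈⟨ bot l ⟩
          t * (a′ * vec d (position j′ j′≉0) l) ≈⟨ *-assoc _ _ _ ⟨
          t * a′ * vec d (position j′ j′≉0) l   ≈⟨ *-congʳ a≈ta′ ⟨
          a * vec d (position j′ j′≉0) l        ∎))

      bottom-member : ∀ j (j≉0 : ¬ IsZeroVector (col j)) x → ∃ λ a → a ≉ 0# × bottom (member j x) ≋ a ⊙ vec d x
      bottom-member j j≉0 x = bottom′-member (zero? (col (member j x)))
        where
        bottom′-member : (j′≈0? : Dec (IsZeroVector (col (member j x)))) →
          ∃ λ a → a ≉ 0# × bottom′ (member j x) j′≈0? ≋ a ⊙ vec d x
        bottom′-member (yes j′≈0) = ⊥-elim (j≉0 (∝-zero (member-∝ j j≉0 x) j′≈0))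
        bottom′-member (no j′≉0)  = scale (member j x) j′≉0 , scale-nonzero (member j x) j′≉0 ,
          λ l → *-congˡ (reflexive (≡.cong (λ y → vec d y l) (position-member j j≉0 x j′≉0)))

    extension-nonzero : ∀ j → ¬ IsZeroVector (column extension j)
    extension-nonzero j Gⱼ≈0 = nonzero (zero? (col j))
      (λ l → trans (sym (bottom≋ j l)) (Gⱼ≈0 (m Fin.↑ʳ l))) (λ i → trans (sym (top≋ j i)) (Gⱼ≈0 (i Fin.↑ˡ d)))
      where
      nonzero : (j≈0? : Dec (IsZeroVector (col j))) → IsZeroVector (bottom′ j j≈0?) → ¬ IsZeroVector (col j)
      nonzero (yes j≈0) b≈0 _   = point-nonzero d _ b≈0
      nonzero (no j≉0)  _   j≈0 = j≉0 j≈0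

    extension-distinct : ∀ j j′ → j ≢ j′ → ¬ column extension j ∝ column extension j′
    extension-distinct j j′ j≢j′ Gⱼ∝Gⱼ′ = j≢j′ (same (zero? (col j)) (zero? (col j′)) (split-∝ Gⱼ∝Gⱼ′))
      where
      same : (j≈0? : Dec (IsZeroVector (col j))) (j′≈0? : Dec (IsZeroVector (col j′))) →
        (∃ λ t → t ≉ 0# × col j ≋ t ⊙ col j′ × bottom′ j j≈0? ≋ t ⊙ bottom′ j′ j′≈0?) → j ≡ j′
      same (yes j≈0) (yes j′≈0) (t , t≉0 , _ , bot) = zero-index-injective j j′ j≈0 j′≈0 (point-∝⇒≡ d _ _ (t , t≉0 , bot))
      same (yes j≈0) (no j′≉0)  (t , t≉0 , top , _) = ⊥-elim (j′≉0 (∝-zero (t , t≉0 , top) j≈0))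
      same (no j≉0)  (yes j′≈0) (t , t≉0 , top , _) = ⊥-elim (j≉0 (∝-zero (∝-sym (t , t≉0 , top)) j′≈0))
      same (no j≉0)  (no j′≉0)  (t , t≉0 , top , bot) = same-class⇒≡ j j′ j≉0 j′≉0 t t≉0 top bot

    module _ (1≤m : 1 ℕ.≤ m) (c : Vector (m ℕ.+ d)) (c·G≈0 : IsZeroVector (c ᵥ* extension)) where

      private
        c₁ : Vector m
        c₁ i = c (i Fin.↑ˡ d)

        c₂ : Vector d
        c₂ l = c (m Fin.↑ʳ l)

        orthogonal : ∀ j → c₁ · col j + c₂ · bottom j ≈ 0#
        orthogonal j = trans (sym (ᵥ*-extension c j)) (c·G≈0 j)

        c₂·bottom-member : ∀ j j≉0 x → c₂ · bottom (member j x) ≈ proj₁ (bottom-member j j≉0 x) * (c₂ · vec d x)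
        c₂·bottom-member j j≉0 x = trans (·-congˡ c₂ (proj₂ (proj₂ (bottom-member j j≉0 x)))) (·-⊙ c₂ (vec d x) _)

        -- A non-zero column is proportional to the member of its class with bottom part 0.
        c₁·col≈0 : ∀ j → c₁ · col j ≈ 0#
        c₁·col≈0 j with zero? (col j)
        ... | yes j≈0 = ·-zeroʳ c₁ j≈0
        ... | no  j≉0 = begin
          c₁ · col j            ≈⟨ ·-congˡ c₁ j≋σj₀ ⟩
          c₁ · (σ ⊙ col j₀)     ≈⟨ ·-⊙ c₁ (col j₀) σ ⟩
          σ * (c₁ · col j₀)     ≈⟨ *-congˡ c₁·colj₀≈0 ⟩
          σ * 0#                ≈⟨ zeroʳ σ ⟩
          0#                    ∎
          where
          open ≈-Reasoning
          j₀ : Fin n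
          j₀ = member j (index d 0ᵥ)
          σ : Carrier
          σ = proj₁ (∝-sym (member-∝ j j≉0 (index d 0ᵥ)))
          j≋σj₀ : col j ≋ σ ⊙ col j₀
          j≋σj₀ = proj₂ (proj₂ (∝-sym (member-∝ j j≉0 (index d 0ᵥ))))
          c₁·colj₀≈0 : c₁ · col j₀ ≈ 0#
          c₁·colj₀≈0 = trans (sym (+-identityʳ _)) (trans (+-congˡ (sym (begin
            c₂ · bottom j₀                                  ≈⟨ c₂·bottom-member j j≉0 (index d 0ᵥ) ⟩
            _ * (c₂ · vec d (index d 0ᵥ))                    ≈⟨ *-congˡ (·-zeroʳ c₂ (vec-index d 0ᵥ)) ⟩
            _ * 0#                                           ≈⟨ zeroʳ _ ⟩
            0#                                               ∎))) (orthogonal j₀))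

        c₁≈0 : IsZeroVector c₁
        c₁≈0 = M-ind c₁ c₁·col≈0

        nonzero-column : ∃ λ j → ¬ IsZeroVector (col j)
        nonzero-column = Fin.¬∀⟶∃¬ n _ (λ j → zero? (col j)) λ M≈0 →
          1≉0 (trans (sym (single-≡ i₀ 1#)) (M-ind (single i₀ 1#) (λ j → ·-zeroʳ (single i₀ 1#) (M≈0 j)) i₀))
          where
          i₀ : Fin m
          i₀ = Fin.fromℕ< 1≤m

        -- A non-zero class has a member whose bottom part is a non-zero multiple of the unit vector eₗ.
        c₂≈0 : IsZeroVector c₂
        c₂≈0 l = nonzero-*-zero a a≉0 (begin
          a * c₂ l                          ≈⟨ *-congˡ (*-identityʳ (c₂ l)) ⟨
          a * (c₂ l * 1#)                   ≈⟨ *-congˡ (·-single c₂ l 1#) ⟨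
          a * (c₂ · single l 1#)            ≈⟨ *-congˡ (·-congˡ c₂ (vec-index d (single l 1#))) ⟨
          a * (c₂ · vec d x)                ≈⟨ c₂·bottom-member j j≉0 x ⟨
          c₂ · bottom (member j x)          ≈⟨ +-identityˡ _ ⟨
          0# + c₂ · bottom (member j x)     ≈⟨ +-congʳ (·-zeroˡ c₁ c₁≈0) ⟨
          c₁ · col (member j x) + c₂ · bottom (member j x) ≈⟨ orthogonal (member j x) ⟩
          0#                                ∎)
          where
          open ≈-Reasoning
          j : Fin n
          j = proj₁ nonzero-column
          j≉0 : ¬ IsZeroVector (col j)
          j≉0 = proj₂ nonzero-column
          x : Fin (q ^ d)
          x = index d (single l 1#)
          a : Carrier
          a = proj₁ (bottom-member j j≉0 x)
          a≉0 : a ≉ 0#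
          a≉0 = proj₁ (proj₂ (bottom-member j j≉0 x))

      c≈0 : IsZeroVector c
      c≈0 i = c-split (Fin.splitAt m i) (Fin.join-splitAt m d i)
        where
        c-split : ∀ s → Fin.join m d s ≡ i → c i ≈ 0#
        c-split (inj₁ i′) eq = trans (reflexive (≡.cong c (≡.sym eq))) (c₁≈0 i′)
        c-split (inj₂ l)  eq = trans (reflexive (≡.cong c (≡.sym eq))) (c₂≈0 l)

    extension-independent : 1 ℕ.≤ m → RowsIndependent extension
    extension-independent 1≤m c c·G≈0 = c≈0 1≤m c c·G≈0

    rowSpace-extension : ∀ v → InRowSpace M v → InRowSpace extension v
    rowSpace-extension v (coef , v≈coef·M) = coef ++ 0ᵥ , λ j → begin
      v j                                  ≈⟨ v≈coef·M j ⟩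
      coef · col j                         ≈⟨ +-identityʳ _ ⟨
      coef · col j + 0#                    ≈⟨ +-cong (∑-cong (λ i → *-congʳ (coef-top i))) (·-zeroˡ {u = bottom j} _ coef-bottom) ⟨
      (λ i → (coef ++ 0ᵥ) (i Fin.↑ˡ d)) · col j + (λ l → (coef ++ 0ᵥ) (m Fin.↑ʳ l)) · bottom j
                                           ≈⟨ ᵥ*-extension (coef ++ 0ᵥ) j ⟨
      ((coef ++ 0ᵥ) ᵥ* extension) j        ∎
      where
      open ≈-Reasoning
      coef-top : ∀ i → (coef ++ 0ᵥ) (i Fin.↑ˡ d) ≈ coef i
      coef-top i = reflexive (lookup-++ˡ coef 0ᵥ i)
      coef-bottom : IsZeroVector (λ l → (coef ++ 0ᵥ) (m Fin.↑ʳ l))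
      coef-bottom l = reflexive (lookup-++ʳ coef 0ᵥ l)

    contained-in-extension : 1 ℕ.≤ m → (X : Pred (Vector n) (c ⊔ ℓ)) → (∀ v → X v → InRowSpace M v) →
      ContainedInSimplexCode (m ℕ.+ d) X
    contained-in-extension 1≤m X X⊆M = InRowSpace extension ,
      (extension , (extension-independent 1≤m , (λ _ v∈C → v∈C) , (λ _ v∈C → v∈C)) , extension-nonzero , extension-distinct) ,
      λ v v∈X → rowSpace-extension v (X⊆M v v∈X)

  row∈rowSpace : ∀ (M : Matrix m k) i → InRowSpace M (M i)
  row∈rowSpace M i = single i 1# , λ j → sym (begin
    ∑ (λ i′ → single i 1# i′ * M i′ j)   ≈⟨ ∑-single _ i (λ i′ i′≢i → trans (*-congʳ (single-≢ 1# i′≢i)) (zeroˡ _)) ⟩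
    single i 1# i * M i j                ≈⟨ *-congʳ (single-≡ i 1#) ⟩
    1# * M i j                           ≈⟨ *-identityˡ _ ⟩
    M i j                                ∎)
    where open ≈-Reasoning

  contained⇒star : m ℕ.≤ k → (X : Pred (Vector ([ k ] q)) (c ⊔ ℓ)) → ContainedInSimplexCode k X →
    (M : Matrix m ([ k ] q)) → IsGeneratorMatrix X M → Star q k M
  contained⇒star m≤k X (C , (G , (_ , C⊆G , _) , G-nonzero , G-distinct) , X⊆C) M (M-ind , _ , M⊆X) =
    star-of-simplex-rows m≤k G G-nonzero G-distinct M M-ind (λ i → C⊆G (M i) (X⊆C (M i) (M⊆X (M i) (row∈rowSpace M i))))

  star⇒contained : 1 ℕ.≤ m → m ℕ.≤ k → (X : Pred (Vector ([ k ] q)) (c ⊔ ℓ)) (M : Matrix m ([ k ] q)) →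
    IsGeneratorMatrix X M → Star q k M → ContainedInSimplexCode k X
  star⇒contained {m} {k} 1≤m m≤k = split-dimension k (k ℕ.∸ m) (ℕ.m+[n∸m]≡n m≤k)
    where
    split-dimension : ∀ k′ d → m ℕ.+ d ≡ k′ → (X : Pred (Vector ([ k′ ] q)) (c ⊔ ℓ)) (M : Matrix m ([ k′ ] q)) →
      IsGeneratorMatrix X M → Star q k′ M → ContainedInSimplexCode k′ X
    split-dimension _ d ≡.refl X M (M-ind , X⊆M , _) (zeros , classes) = contained-in-extension M M-ind
      (≡.subst (HasExactly _) (≡.cong (λ e → [ e ] q) (ℕ.m+n∸m≡n m d)) zeros)
      (λ j j≉0 → ≡.subst (HasExactly _) (≡.cong (q ^_) (ℕ.m+n∸m≡n m d)) (classes j j≉0)) 1≤m X X⊆M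

proposition1 : ∀ {c ℓ : Level} (F : CommutativeRing c ℓ) → IsDiscreteField F →
    (q : ℕ) → HasSize F q →
    (k : ℕ) → 2 ≤ k → (m : ℕ) → 1 ≤ m → m ≤ k →
    ((X : Pred (LinAlg.Vector F ([ k ] q)) (c ⊔ ℓ)) → LinAlg.IsSubspaceOfDim F X m →
      LinAlg.ContainedInSimplexCode F k X →
      (M : LinAlg.Matrix F m ([ k ] q)) → LinAlg.IsGeneratorMatrix F X M →
      LinAlg.Star F q k M)
    ×
    ((X : Pred (LinAlg.Vector F ([ k ] q)) (c ⊔ ℓ)) →
      (M : LinAlg.Matrix F m ([ k ] q)) → LinAlg.IsGeneratorMatrix F X M →
      LinAlg.Star F q k M →
      LinAlg.ContainedInSimplexCode F k X)
proposition1 F isField q size k _ m 1≤m m≤k = (λ X _ → contained⇒star m≤k X) , star⇒contained 1≤m m≤k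
  where open FiniteField F isField q size
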